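{- Let $n\ge 1$ and $0\le k\le n$ be integers. For a set $W\subseteq\{1,\dots,n\}$, let $N(W)$ be the number of valid fillings of the $n\times 2$ grid with respect to $W$. Then the average of $N(W)$ over all $\binom{n}{k}$ subsets $W$ with $|W|=k$ equals $$\frac{1}{n+1-k}\binom{2n}{n}.$$
   Context: Consider a rectangular grid with $n$ rows, numbered $1,\dots,n$ from bottom to top, and $2$ columns. A filling is a bijection from the $2n$ cells to $\{1,2,\dots,2n\}$. Given a set $W\subseteq\{1,\dots,n\}$ of rows, said to carry a vertical wall between their two cells, a filling is valid with respect to $W$ if it satisfies three conditions. (i) The labels in each column increase from bottom to top. (ii) In every row not in $W$, the left label is smaller than the right label. (iii) In a row belonging to $W$, no order constraint is imposed between its two cells. Thus the $W$-positions with walls are chosen uniformly at random among $k$-subsets of rows, and $N(W)$ is the number of linear extensions of the corresponding partial order. -}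

module Defs where

open import Data.Bool using (Bool; true; false; _∧_; _∨_; not; if_then_else_)
open import Data.Nat using (ℕ; zero; suc; _+_; _*_; _<ᵇ_; _≡ᵇ_)
open import Data.Fin using (Fin; toℕ; zero; suc)
open import Data.Product using (_×_; _,_; proj₁; proj₂)
open import Data.List using (List; []; _∷_; map; concatMap; cartesianProduct; length; filterᵇ)
open import Data.Bool.ListAction using (all; any)
open import Data.Nat.ListAction using (sum)
open import Data.Vec using (Vec; []; _∷_; lookup)
open import Data.Fin.Subset using (Subset; ∣_∣)
import Data.List as L

allVecs : ∀ {a} {A : Set a} → List A → (n : ℕ) → List (Vec A n)
allVecs xs zero    = [] ∷ []
allVecs xs (suc n) = concatMap (λ x → map (x ∷_) (allVecs xs n)) xs

-- Cells of the n×2 grid: (row, column). Row 0 is the bottom row (row 1 of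
-- the paper); column 0 is the left column, column 1 the right column.
Cell : ℕ → Set
Cell n = Fin n × Fin 2

allCells : (n : ℕ) → List (Cell n)
allCells n = cartesianProduct (L.allFin n) (L.allFin 2)

-- A candidate filling: each row gets a pair (left label, right label).
-- Labels are taken in Fin (2n) = {0,…,2n-1}, order-isomorphic to {1,…,2n}.
Filling : ℕ → Set
Filling n = Vec (Fin (2 * n) × Fin (2 * n)) n

label : ∀ {n} → Filling n → Cell n → Fin (2 * n)
label f (i , zero)  = proj₁ (lookup f i)
label f (i , suc _) = proj₂ (lookup f i)

_=ᶠ_ : ∀ {m} → Fin m → Fin m → Bool
a =ᶠ b = toℕ a ≡ᵇ toℕ b

_=ᶜ_ : ∀ {n} → Cell n → Cell n → Bool
(i , c) =ᶜ (j , d) = (i =ᶠ j) ∧ (c =ᶠ d)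

isBijective : ∀ {n} → Filling n → Bool
isBijective {n} f =
  all (λ c → all (λ c' → not (label f c =ᶠ label f c') ∨ (c =ᶜ c')) (allCells n)) (allCells n)
  ∧ all (λ l → any (λ c → label f c =ᶠ l) (allCells n)) (L.allFin (2 * n))

_<ᶠ_ : ∀ {m} → Fin m → Fin m → Bool
a <ᶠ b = toℕ a <ᵇ toℕ b

columnsIncrease : ∀ {n} → Filling n → Bool
columnsIncrease {n} f =
  all (λ i → all (λ j → not (toℕ i <ᵇ toℕ j)
        ∨ ((proj₁ (lookup f i) <ᶠ proj₁ (lookup f j)) ∧ (proj₂ (lookup f i) <ᶠ proj₂ (lookup f j))))
      (L.allFin n)) (L.allFin n)

rowsOK : ∀ {n} → Subset n → Filling n → Bool
rowsOK {n} W f =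
  all (λ i → lookup W i ∨ (proj₁ (lookup f i) <ᶠ proj₂ (lookup f i))) (L.allFin n)

isValid : ∀ {n} → Subset n → Filling n → Bool
isValid W f = isBijective f ∧ columnsIncrease f ∧ rowsOK W f

N : ∀ {n} → Subset n → ℕ
N {n} W = length (filterᵇ (isValid W)
  (allVecs (cartesianProduct (L.allFin (2 * n)) (L.allFin (2 * n))) n))

subsetsOfSize : (n k : ℕ) → List (Subset n)
subsetsOfSize n k = filterᵇ (λ W → ∣ W ∣ ≡ᵇ k) (allVecs (true ∷ false ∷ []) n)

sumN : (n k : ℕ) → ℕ
sumN n k = sum (map N (subsetsOfSize n k))

module Submission where

-- A valid filling is encoded by its word w ∈ {true, false}^{2n}: letter ℓ
-- says whether label ℓ lies in the left column.  Row i holds the i-th left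
-- and the i-th right label, and it breaks "left < right" exactly when the
-- i-th false of w, read as a down step of a lattice walk, is a *flaw* (taken
-- from height ≤ 0).  Hence N(W) counts the balanced words whose flawed rows
-- are all walls, and double counting gives
--   Σ_{|W|=k} N(W) = Σ_w C(n − j_w, k − j_w) = Σ_{j≤n} F(n, j) · C(n − j, k − j),
-- F(n, j) being the number of balanced words with j flaws.  By Chung–Feller
-- F(n, j) = F(n, 0) for all j, and (n+1)·F(n, 0) = C(2n, n); the hockey stick
-- Σ_j C(n−j, k−j) = C(n+1, k) and (n+1−k)·C(n+1, k) = (n+1)·C(n, k) finish.

open import Defs
open import Data.Nat using (ℕ; _+_; _*_; _∸_; _≤_)
open import Data.Nat.Combinatorics using (_C_)
open import Relation.Binary.PropositionalEquality using (_≡_)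
open import Data.Nat using (suc)
open import Data.Nat.Properties using (≤-trans; n≤1+n; +-comm; +-identityʳ)
open import Relation.Binary.PropositionalEquality using (refl; sym; cong; cong₂; trans; module ≡-Reasoning)
open import Data.Nat.Solver using (module +-*-Solver)
open +-*-Solver using (solve; _:*_; _:=_)

module BooleanTests where

  open import Data.Bool using (true; false; _∧_; _∨_)
  open import Data.Bool.Properties using (T-≡)
  open import Data.Nat using (_+_; _≤_; _<_; _≡ᵇ_; _<ᵇ_; _≤ᵇ_)
  open import Data.Nat.Properties
  open import Data.Product using (_×_; _,_)
  open import Data.Sum using (_⊎_; inj₁; inj₂)
  open import Data.Empty using (⊥-elim)
  open import Function using (Equivalence)
  open import Relation.Nullary using (¬_)
  open import Relation.Binary.PropositionalEquality

  ∧-elim : ∀ {a b} → (a ∧ b) ≡ true → a ≡ true × b ≡ true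
  ∧-elim {true} e = refl , e

  ∧-intro : ∀ {a b} → a ≡ true → b ≡ true → (a ∧ b) ≡ true
  ∧-intro refl b≡ = b≡

  ∨-elim : ∀ {a b} → (a ∨ b) ≡ true → a ≡ true ⊎ b ≡ true
  ∨-elim {true}  e = inj₁ refl
  ∨-elim {false} e = inj₂ e

  ∨-introʳ : ∀ a {b} → b ≡ true → (a ∨ b) ≡ true
  ∨-introʳ true  e = refl
  ∨-introʳ false e = e

  ≡ᵇ-sound : ∀ m n → (m ≡ᵇ n) ≡ true → m ≡ n
  ≡ᵇ-sound m n e = ≡ᵇ⇒≡ m n (Equivalence.from T-≡ e)

  ≡ᵇ-complete : ∀ {m n} → m ≡ n → (m ≡ᵇ n) ≡ true
  ≡ᵇ-complete {m} {n} m≡n = Equivalence.to T-≡ (≡⇒≡ᵇ m n m≡n)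

  ≡ᵇ-refl : ∀ n → (n ≡ᵇ n) ≡ true
  ≡ᵇ-refl n = ≡ᵇ-complete {n} refl

  ≡ᵇ-false : ∀ m n → m ≢ n → (m ≡ᵇ n) ≡ false
  ≡ᵇ-false m n m≢n with m ≡ᵇ n in e
  ... | true  = ⊥-elim (m≢n (≡ᵇ-sound m n e))
  ... | false = refl

  <ᵇ-sound : ∀ m n → (m <ᵇ n) ≡ true → m < n
  <ᵇ-sound m n e = <ᵇ⇒< m n (Equivalence.from T-≡ e)

  <ᵇ-complete : ∀ {m n} → m < n → (m <ᵇ n) ≡ true
  <ᵇ-complete m<n = Equivalence.to T-≡ (<⇒<ᵇ m<n)

  <ᵇ-false : ∀ m n → n ≤ m → (m <ᵇ n) ≡ false
  <ᵇ-false m n n≤m with m <ᵇ n in e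
  ... | true  = ⊥-elim (<⇒≱ (<ᵇ-sound m n e) n≤m)
  ... | false = refl

  ≤ᵇ-true : ∀ {m n} → m ≤ n → (m ≤ᵇ n) ≡ true
  ≤ᵇ-true m≤n = Equivalence.to T-≡ (≤⇒≤ᵇ m≤n)

  ≤ᵇ-false : ∀ {m n} → n < m → (m ≤ᵇ n) ≡ false
  ≤ᵇ-false {m} {n} n<m with m ≤ᵇ n in e
  ... | true  = ⊥-elim (<⇒≱ n<m (≤ᵇ⇒≤ m n (Equivalence.from T-≡ e)))
  ... | false = refl

  ≤ᵇ-shift : ∀ c m n → (c + m ≤ᵇ c + n) ≡ (m ≤ᵇ n)
  ≤ᵇ-shift c m n with m ≤ᵇ n in e
  ... | true  = ≤ᵇ-true (+-monoʳ-≤ c (≤ᵇ⇒≤ m n (Equivalence.from T-≡ e)))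
  ... | false = ≤ᵇ-false (+-monoʳ-< c (≰⇒> m≰n))
    where
    m≰n : ¬ m ≤ n
    m≰n m≤n with () ← trans (sym (≤ᵇ-true m≤n)) e

module ListCounting where

  open import Data.Bool using (Bool; true; false; _∧_)
  open import Data.Bool.ListAction using (all; any)
  open BooleanTests using (∧-elim; ∨-elim; ∨-introʳ)
  open import Data.Bool.Properties using (T-≡)
  open import Data.Nat using (ℕ; zero; suc; _+_; _*_; _≤_; _<_; _≡ᵇ_; z≤n; s≤s)
  open import Data.Nat.Properties
    using (≤-antisym; ≤-trans; ≤-reflexive; +-suc; +-identityʳ; *-zeroʳ; *-distribˡ-+; *-distribʳ-+)
  open import Algebra.Properties.CommutativeSemigroup Data.Nat.Properties.+-commutativeSemigroup
    using () renaming (interchange to +-interchange)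
  open import Data.List using (List; []; _∷_; _++_; map; length; filterᵇ)
  open import Data.List.Properties using (length-++; length-map; filter-++)
  open import Data.Nat.ListAction using (sum)
  open import Data.Product using (_×_; _,_; proj₁; proj₂; Σ)
  open import Data.Sum using (inj₁; inj₂)
  open import Data.Empty using (⊥-elim)
  open import Function using (_∘_; Equivalence)
  open import Relation.Nullary.Decidable using (T?)
  open import Relation.Binary.PropositionalEquality
  open import Data.List.Membership.Propositional using (_∈_)
  open import Data.List.Membership.Propositional.Properties
    using (∈-∃++; ∈-++⁻; ∈-++⁺ˡ; ∈-++⁺ʳ; ∈-map⁻; ∈-filter⁺; ∈-filter⁻)
  open import Data.List.Relation.Unary.Any using (here; there)
  open import Data.List.Relation.Unary.All using (tabulate; lookup)
  import Data.List.Relation.Unary.All.Properties as AllP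
  open import Data.List.Relation.Unary.Unique.Propositional using (Unique; []; _∷_)
  import Data.List.Relation.Unary.Unique.Propositional.Properties as Unique

  indicator : Bool → ℕ
  indicator true  = 1
  indicator false = 0

  ∈-filterᵇ⁻ : ∀ {A : Set} (p : A → Bool) {x} (xs : List A) →
    x ∈ filterᵇ p xs → x ∈ xs × p x ≡ true
  ∈-filterᵇ⁻ p xs m =
    let (m′ , px) = ∈-filter⁻ (T? ∘ p) {xs = xs} m in m′ , Equivalence.to T-≡ px

  ∈-filterᵇ⁺ : ∀ {A : Set} (p : A → Bool) {x} (xs : List A) →
    x ∈ xs → p x ≡ true → x ∈ filterᵇ p xs
  ∈-filterᵇ⁺ p xs m px = ∈-filter⁺ (T? ∘ p) m (Equivalence.from T-≡ px)

  filterᵇ-accept : ∀ {A : Set} (p : A → Bool) {x xs} → p x ≡ true → filterᵇ p (x ∷ xs) ≡ x ∷ filterᵇ p xs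
  filterᵇ-accept p px rewrite px = refl

  filterᵇ-reject : ∀ {A : Set} (p : A → Bool) {x xs} → p x ≡ false → filterᵇ p (x ∷ xs) ≡ filterᵇ p xs
  filterᵇ-reject p px rewrite px = refl

  all-elim : ∀ {A : Set} (p : A → Bool) (xs : List A) {x} → all p xs ≡ true → x ∈ xs → p x ≡ true
  all-elim p (y ∷ xs) e (here refl) = proj₁ (∧-elim e)
  all-elim p (y ∷ xs) e (there m)   = all-elim p xs (proj₂ (∧-elim {p y} e)) m

  all-intro : ∀ {A : Set} (p : A → Bool) (xs : List A) → (∀ {x} → x ∈ xs → p x ≡ true) → all p xs ≡ true
  all-intro p []       h = refl
  all-intro p (y ∷ xs) h rewrite h (here refl) = all-intro p xs (h ∘ there)

  any-elim : ∀ {A : Set} (p : A → Bool) (xs : List A) → any p xs ≡ true → Σ A (λ x → x ∈ xs × p x ≡ true)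
  any-elim p (y ∷ xs) e with ∨-elim {p y} e
  ... | inj₁ py = y , here refl , py
  ... | inj₂ e′ = let (x , m , px) = any-elim p xs e′ in x , there m , px

  any-intro : ∀ {A : Set} (p : A → Bool) (xs : List A) {x} → x ∈ xs → p x ≡ true → any p xs ≡ true
  any-intro p (y ∷ xs) (here refl) px rewrite px = refl
  any-intro p (y ∷ xs) (there m)   px = ∨-introʳ (p y) (any-intro p xs m px)

  length-filterᵇ-∷ : ∀ {A : Set} (p : A → Bool) x xs →
    length (filterᵇ p (x ∷ xs)) ≡ indicator (p x) + length (filterᵇ p xs)
  length-filterᵇ-∷ p x xs with p x
  ... | true  = refl
  ... | false = refl

  length-filterᵇ-++ : ∀ {A : Set} (p : A → Bool) (xs ys : List A) →
    length (filterᵇ p (xs ++ ys)) ≡ length (filterᵇ p xs) + length (filterᵇ p ys)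
  length-filterᵇ-++ p xs ys = trans (cong length (filter-++ (T? ∘ p) xs ys)) (length-++ (filterᵇ p xs))

  length-filterᵇ-map : ∀ {A B : Set} (p : B → Bool) (f : A → B) (xs : List A) →
    length (filterᵇ p (map f xs)) ≡ length (filterᵇ (λ x → p (f x)) xs)
  length-filterᵇ-map p f [] = refl
  length-filterᵇ-map p f (x ∷ xs) with p (f x)
  ... | true  = cong suc (length-filterᵇ-map p f xs)
  ... | false = length-filterᵇ-map p f xs

  length-filterᵇ-filterᵇ : ∀ {A : Set} (p q : A → Bool) (xs : List A) →
    length (filterᵇ q (filterᵇ p xs)) ≡ length (filterᵇ (λ x → p x ∧ q x) xs)
  length-filterᵇ-filterᵇ p q [] = refl
  length-filterᵇ-filterᵇ p q (x ∷ xs) with p x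
  ... | false = length-filterᵇ-filterᵇ p q xs
  ... | true with q x
  ...   | true  = cong suc (length-filterᵇ-filterᵇ p q xs)
  ...   | false = length-filterᵇ-filterᵇ p q xs

  length-filterᵇ-none : ∀ {A : Set} (p : A → Bool) (xs : List A) → (∀ x → p x ≡ false) →
    length (filterᵇ p xs) ≡ 0
  length-filterᵇ-none p [] h = refl
  length-filterᵇ-none p (x ∷ xs) h =
    trans (length-filterᵇ-∷ p x xs) (cong₂ _+_ (cong indicator (h x)) (length-filterᵇ-none p xs h))

  unique-⊆⇒length-≤ : ∀ {A : Set} (as bs : List A) → Unique as →
    (∀ {x} → x ∈ as → x ∈ bs) → length as ≤ length bs
  unique-⊆⇒length-≤ [] bs u sub = z≤n
  unique-⊆⇒length-≤ (a ∷ as) bs (a∉as ∷ u) sub with ∈-∃++ (sub (here refl))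
  ... | bs₁ , bs₂ , refl =
    ≤-trans (s≤s (unique-⊆⇒length-≤ as (bs₁ ++ bs₂) u sub′)) (≤-reflexive (sym length-split))
    where
    length-split : length (bs₁ ++ a ∷ bs₂) ≡ suc (length (bs₁ ++ bs₂))
    length-split = begin
      length (bs₁ ++ a ∷ bs₂)        ≡⟨ length-++ bs₁ ⟩
      length bs₁ + suc (length bs₂)  ≡⟨ +-suc (length bs₁) (length bs₂) ⟩
      suc (length bs₁ + length bs₂)  ≡⟨ cong suc (length-++ bs₁) ⟨
      suc (length (bs₁ ++ bs₂))      ∎
      where open ≡-Reasoning
    sub′ : ∀ {x} → x ∈ as → x ∈ bs₁ ++ bs₂
    sub′ m with ∈-++⁻ bs₁ (sub (there m))
    ... | inj₁ m₁ = ∈-++⁺ˡ m₁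
    ... | inj₂ (here refl) = ⊥-elim (lookup a∉as m refl)
    ... | inj₂ (there m₂) = ∈-++⁺ʳ bs₁ m₂

  unique-map : ∀ {A B : Set} (f : A → B) (xs : List A) → Unique xs →
    (∀ {x y} → x ∈ xs → y ∈ xs → f x ≡ f y → x ≡ y) → Unique (map f xs)
  unique-map f [] u inj = []
  unique-map f (x ∷ xs) (x∉xs ∷ u) inj =
    AllP.map⁺ (tabulate (λ m e → lookup x∉xs m (inj (here refl) (there m) e))) ∷
    unique-map f xs u (λ mx my → inj (there mx) (there my))

  count-≤ : ∀ {A B : Set} (xs : List A) (ys : List B) (P : A → Bool) (Q : B → Bool)
    (f : A → B) (g : B → A) → Unique xs →
    (∀ {x} → x ∈ xs → P x ≡ true → (f x ∈ ys) × (Q (f x) ≡ true) × (g (f x) ≡ x)) →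
    length (filterᵇ P xs) ≤ length (filterᵇ Q ys)
  count-≤ xs ys P Q f g uxs forth =
    ≤-trans (≤-reflexive (sym (length-map f (filterᵇ P xs))))
      (unique-⊆⇒length-≤ (map f (filterᵇ P xs)) (filterᵇ Q ys)
        (unique-map f (filterᵇ P xs) (Unique.filter⁺ (T? ∘ P) uxs) injective) image⊆)
    where
    injective : ∀ {x y} → x ∈ filterᵇ P xs → y ∈ filterᵇ P xs → f x ≡ f y → x ≡ y
    injective mx my e =
      let (mx′ , px) = ∈-filterᵇ⁻ P xs mx
          (my′ , py) = ∈-filterᵇ⁻ P xs my
      in trans (sym (proj₂ (proj₂ (forth mx′ px))))
               (trans (cong g e) (proj₂ (proj₂ (forth my′ py))))
    image⊆ : ∀ {z} → z ∈ map f (filterᵇ P xs) → z ∈ filterᵇ Q ys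
    image⊆ m with ∈-map⁻ f m
    ... | x , mx , refl with ∈-filterᵇ⁻ P xs mx
    ... | mx′ , px with forth mx′ px
    ... | fx∈ys , qfx , _ = ∈-filterᵇ⁺ Q ys fx∈ys qfx

  count-bijection : ∀ {A B : Set} (xs : List A) (ys : List B) (P : A → Bool) (Q : B → Bool)
    (f : A → B) (g : B → A) → Unique xs → Unique ys →
    (∀ {x} → x ∈ xs → P x ≡ true → (f x ∈ ys) × (Q (f x) ≡ true) × (g (f x) ≡ x)) →
    (∀ {y} → y ∈ ys → Q y ≡ true → (g y ∈ xs) × (P (g y) ≡ true) × (f (g y) ≡ y)) →
    length (filterᵇ P xs) ≡ length (filterᵇ Q ys)
  count-bijection xs ys P Q f g uxs uys forth back =
    ≤-antisym (count-≤ xs ys P Q f g uxs forth) (count-≤ ys xs Q P g f uys back)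

  sum-map-+ : ∀ {A : Set} (f g : A → ℕ) (xs : List A) →
    sum (map (λ x → f x + g x) xs) ≡ sum (map f xs) + sum (map g xs)
  sum-map-+ f g [] = refl
  sum-map-+ f g (x ∷ xs) =
    trans (cong (f x + g x +_) (sum-map-+ f g xs)) (+-interchange (f x) (g x) _ _)

  sum-map-cong : ∀ {A : Set} (f g : A → ℕ) (xs : List A) →
    (∀ {x} → x ∈ xs → f x ≡ g x) → sum (map f xs) ≡ sum (map g xs)
  sum-map-cong f g [] h = refl
  sum-map-cong f g (x ∷ xs) h = cong₂ _+_ (h (here refl)) (sum-map-cong f g xs (h ∘ there))

  double-counting : ∀ {A B : Set} (R : A → B → Bool) (as : List A) (bs : List B) →
    sum (map (λ a → length (filterᵇ (R a) bs)) as) ≡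
    sum (map (λ b → length (filterᵇ (λ a → R a b) as)) bs)
  double-counting R [] bs = sym (sum-zero bs)
    where
    sum-zero : ∀ {B : Set} (bs : List B) → sum (map (λ _ → 0) bs) ≡ 0
    sum-zero [] = refl
    sum-zero (_ ∷ bs) = sum-zero bs
  double-counting R (a ∷ as) bs = begin
    length (filterᵇ (R a) bs) + sum (map (λ a → length (filterᵇ (R a) bs)) as)
      ≡⟨ cong₂ _+_ (count-as-sum bs) (double-counting R as bs) ⟩
    sum (map (λ b → indicator (R a b)) bs) + sum (map (λ b → length (filterᵇ (λ a → R a b) as)) bs)
      ≡⟨ sum-map-+ (λ b → indicator (R a b)) (λ b → length (filterᵇ (λ a → R a b) as)) bs ⟨
    sum (map (λ b → indicator (R a b) + length (filterᵇ (λ a → R a b) as)) bs)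
      ≡⟨ sum-map-cong _ _ bs (λ {b} _ → sym (length-filterᵇ-∷ (λ a → R a b) a as)) ⟩
    sum (map (λ b → length (filterᵇ (λ a → R a b) (a ∷ as))) bs)
      ∎
    where
    open ≡-Reasoning
    count-as-sum : ∀ bs → length (filterᵇ (R a) bs) ≡ sum (map (λ b → indicator (R a b)) bs)
    count-as-sum [] = refl
    count-as-sum (b ∷ bs) = trans (length-filterᵇ-∷ (R a) b bs) (cong (indicator (R a b) +_) (count-as-sum bs))

  sumBelow : (ℕ → ℕ) → ℕ → ℕ
  sumBelow f zero    = 0
  sumBelow f (suc N) = f 0 + sumBelow (λ j → f (suc j)) N

  sumBelow-cong : ∀ f g N → (∀ j → j < N → f j ≡ g j) → sumBelow f N ≡ sumBelow g N
  sumBelow-cong f g zero    h = refl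
  sumBelow-cong f g (suc N) h =
    cong₂ _+_ (h 0 (s≤s z≤n)) (sumBelow-cong _ _ N (λ j p → h (suc j) (s≤s p)))

  sumBelow-zero : ∀ f N → (∀ j → f j ≡ 0) → sumBelow f N ≡ 0
  sumBelow-zero f zero    h = refl
  sumBelow-zero f (suc N) h = cong₂ _+_ (h 0) (sumBelow-zero _ N (λ j → h (suc j)))

  sumBelow-+ : ∀ f g N → sumBelow (λ j → f j + g j) N ≡ sumBelow f N + sumBelow g N
  sumBelow-+ f g zero    = refl
  sumBelow-+ f g (suc N) = trans (cong (f 0 + g 0 +_) (sumBelow-+ _ _ N))
    (+-interchange (f 0) (g 0) _ _)

  sumBelow-* : ∀ c f N → sumBelow (λ j → c * f j) N ≡ c * sumBelow f N
  sumBelow-* c f zero    = sym (*-zeroʳ c)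
  sumBelow-* c f (suc N) =
    trans (cong (c * f 0 +_) (sumBelow-* c _ N)) (sym (*-distribˡ-+ c (f 0) _))

  sumBelow-const : ∀ c N → sumBelow (λ _ → c) N ≡ N * c
  sumBelow-const c zero    = refl
  sumBelow-const c (suc N) = cong (c +_) (sumBelow-const c N)

  sumBelow-delta : ∀ h N a → a < N → sumBelow (λ j → indicator (a ≡ᵇ j) * h j) N ≡ h a
  sumBelow-delta h (suc N) zero _ =
    trans (cong₂ _+_ (+-identityʳ (h 0)) (sumBelow-zero _ N (λ j → refl))) (+-identityʳ (h 0))
  sumBelow-delta h (suc N) (suc a) (s≤s p) = sumBelow-delta (λ j → h (suc j)) N a p

  sum-by-value : ∀ {A : Set} (v : A → ℕ) (h : ℕ → ℕ) N (xs : List A) → (∀ {x} → x ∈ xs → v x < N) →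
    sum (map (λ x → h (v x)) xs) ≡ sumBelow (λ j → length (filterᵇ (λ x → v x ≡ᵇ j) xs) * h j) N
  sum-by-value v h N [] bound = sym (sumBelow-zero _ N (λ j → refl))
  sum-by-value v h N (x ∷ xs) bound = begin
    h (v x) + sum (map (λ x → h (v x)) xs)
      ≡⟨ cong₂ _+_ (sym (sumBelow-delta h N (v x) (bound (here refl)))) (sum-by-value v h N xs (bound ∘ there)) ⟩
    sumBelow (λ j → indicator (v x ≡ᵇ j) * h j) N + sumBelow (λ j → count xs j * h j) N
      ≡⟨ sumBelow-+ _ _ N ⟨
    sumBelow (λ j → indicator (v x ≡ᵇ j) * h j + count xs j * h j) N
      ≡⟨ sumBelow-cong _ _ N (λ j _ → *-distribʳ-+ (h j) (indicator (v x ≡ᵇ j)) (count xs j)) ⟨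
    sumBelow (λ j → (indicator (v x ≡ᵇ j) + count xs j) * h j) N
      ≡⟨ sumBelow-cong _ _ N (λ j _ → cong (_* h j) (length-filterᵇ-∷ (λ y → v y ≡ᵇ j) x xs)) ⟨
    sumBelow (λ j → count (x ∷ xs) j * h j) N
      ∎
    where
    open ≡-Reasoning
    count : List _ → ℕ → ℕ
    count ys j = length (filterᵇ (λ y → v y ≡ᵇ j) ys)

module Binomials where

  open import Data.Nat using (ℕ; zero; suc; _+_; _*_; _∸_; _≤_; _<_; z≤n; s≤s)
  open import Data.Nat.Properties
  open import Data.Nat.Combinatorics using (_C_; nCk+nC[k+1]≡[n+1]C[k+1])
  open import Relation.Binary.PropositionalEquality
  open import Data.Nat.Solver using (module +-*-Solver)
  open +-*-Solver
  open ListCounting using (sumBelow; sumBelow-zero)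

  binom : ℕ → ℕ → ℕ
  binom n       zero    = 1
  binom zero    (suc k) = 0
  binom (suc n) (suc k) = binom n k + binom n (suc k)

  binom≡C : ∀ n k → binom n k ≡ n C k
  binom≡C n       zero    = refl
  binom≡C zero    (suc k) = refl
  binom≡C (suc n) (suc k) =
    trans (cong₂ _+_ (binom≡C n k) (binom≡C n (suc k))) (nCk+nC[k+1]≡[n+1]C[k+1] n k)

  binom-> : ∀ n k → n < k → binom n k ≡ 0
  binom-> zero    (suc k) _       = refl
  binom-> (suc n) (suc k) (s≤s p) = cong₂ _+_ (binom-> n k p) (binom-> n (suc k) (m<n⇒m<1+n p))

  binom-diag : ∀ n → binom n n ≡ 1
  binom-diag zero    = refl
  binom-diag (suc n) = cong₂ _+_ (binom-diag n) (binom-> n (suc n) ≤-refl)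

  binom-1 : ∀ n → binom n 1 ≡ n
  binom-1 zero    = refl
  binom-1 (suc n) = cong suc (binom-1 n)

  absorption : ∀ n k → suc k * binom (suc n) (suc k) ≡ suc n * binom n k
  absorption zero zero = refl
  absorption zero (suc k) =
    trans (cong (suc (suc k) *_) (binom-> 1 (suc (suc k)) (s≤s (s≤s z≤n)))) (*-zeroʳ (suc (suc k)))
  absorption (suc n) zero =
    trans (+-identityʳ _) (trans (cong suc (binom-1 (suc n))) (sym (*-identityʳ _)))
  absorption (suc n) (suc k) = begin
    suc (suc k) * (binom (suc n) (suc k) + binom (suc n) (suc (suc k)))
      ≡⟨ solve 3 (λ k x y → (con 2 :+ k) :* (x :+ y) := (con 1 :+ k) :* x :+ x :+ (con 2 :+ k) :* y)
               refl k (binom (suc n) (suc k)) (binom (suc n) (suc (suc k))) ⟩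
    suc k * binom (suc n) (suc k) + binom (suc n) (suc k) + suc (suc k) * binom (suc n) (suc (suc k))
      ≡⟨ cong₂ (λ a b → a + binom (suc n) (suc k) + b) (absorption n k) (absorption n (suc k)) ⟩
    suc n * binom n k + (binom n k + binom n (suc k)) + suc n * binom n (suc k)
      ≡⟨ solve 3 (λ n a b → (con 1 :+ n) :* a :+ (a :+ b) :+ (con 1 :+ n) :* b := (con 2 :+ n) :* (a :+ b))
               refl n (binom n k) (binom n (suc k)) ⟩
    suc (suc n) * binom (suc n) (suc k)
      ∎
    where open ≡-Reasoning

  complement-absorption : ∀ n k → k ≤ suc n → (suc n ∸ k) * binom (suc n) k ≡ suc n * binom n k
  complement-absorption n zero _ = refl
  complement-absorption n (suc k) (s≤s k≤n) = +-cancelˡ-≡ (suc n * binom n k) _ _ (begin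
    suc n * binom n k + (n ∸ k) * binom (suc n) (suc k)
      ≡⟨ cong (_+ (n ∸ k) * binom (suc n) (suc k)) (absorption n k) ⟨
    suc k * binom (suc n) (suc k) + (n ∸ k) * binom (suc n) (suc k)
      ≡⟨ *-distribʳ-+ (binom (suc n) (suc k)) (suc k) (n ∸ k) ⟨
    (suc k + (n ∸ k)) * binom (suc n) (suc k)
      ≡⟨ cong (λ m → suc m * binom (suc n) (suc k)) (m+[n∸m]≡n k≤n) ⟩
    suc n * (binom n k + binom n (suc k))
      ≡⟨ *-distribˡ-+ (suc n) (binom n k) (binom n (suc k)) ⟩
    suc n * binom n k + suc n * binom n (suc k)
      ∎)
    where open ≡-Reasoning

  -- supersets n k j = C(n−j, k−j): the number of k-subsets of an n-set
  -- that contain a fixed j-subset.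
  supersets : ℕ → ℕ → ℕ → ℕ
  supersets n       k       zero    = binom n k
  supersets zero    k       (suc j) = 0
  supersets (suc n) zero    (suc j) = 0
  supersets (suc n) (suc k) (suc j) = supersets n k j

  -- Those k-subsets of an (n+1)-set that contain a given new element:
  -- (k−1)-subsets of the remaining n-set (none when k = 0).
  supersetsWith : ℕ → ℕ → ℕ → ℕ
  supersetsWith n zero    j = 0
  supersetsWith n (suc k) j = supersets n k j

  -- The new element belongs to the fixed set: it must be chosen.
  supersets-fixed : ∀ n k j → supersets (suc n) k (suc j) ≡ supersetsWith n k j
  supersets-fixed n zero    j = refl
  supersets-fixed n (suc k) j = refl

  -- The new element is outside the fixed set: it may or may not be chosen.
  supersets-free : ∀ n k j → j ≤ n → supersets (suc n) k j ≡ supersetsWith n k j + supersets n k j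
  supersets-free n       zero    zero    _       = refl
  supersets-free n       (suc k) zero    _       = refl
  supersets-free (suc n) zero    (suc j) (s≤s p) = refl
  supersets-free (suc n) (suc k) (suc j) (s≤s p) =
    trans (supersets-free n k j p) (cong (_+ supersets n k j) (sym (supersets-fixed n k j)))

  hockey-stick : ∀ n k → k ≤ n → sumBelow (supersets n k) (suc n) ≡ binom (suc n) k
  hockey-stick zero    zero    _       = refl
  hockey-stick (suc n) zero    _       = cong suc (sumBelow-zero _ (suc n) (λ j → refl))
  hockey-stick (suc n) (suc k) (s≤s p) =
    trans (cong (binom (suc n) (suc k) +_) (hockey-stick n k p)) (+-comm (binom (suc n) (suc k)) (binom (suc n) k))

-- Words over {true, false}; true is an up step, false a down step.  The
-- balanced words with n letters of each kind encode the fillings.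
module LatticeWords where

  open import Data.Bool using (Bool; true; false)
  open import Data.Nat using (ℕ; zero; suc; _+_; _*_; _≤_)
  open import Data.Nat.Properties using (+-suc; +-identityʳ; m≤m+n)
  open import Data.List using (List; []; _∷_; _++_; map; length)
  open import Data.List.Properties using (length-++; length-map; ∷-injectiveʳ)
  open import Data.Product using (_×_; _,_; proj₁; proj₂)
  open import Data.Sum using (inj₁; inj₂)
  open import Data.Empty using (⊥)
  open import Relation.Binary.PropositionalEquality
  open import Data.List.Membership.Propositional using (_∈_)
  open import Data.List.Membership.Propositional.Properties using (∈-map⁺; ∈-map⁻; ∈-++⁺ˡ; ∈-++⁺ʳ; ∈-++⁻)
  open import Data.List.Relation.Unary.Any using (here)
  open import Data.List.Relation.Unary.Unique.Propositional using (Unique; []; _∷_)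
  import Data.List.Relation.Unary.Unique.Propositional.Properties as Unique
  import Data.List.Relation.Unary.All as All
  open Binomials using (binom; binom-diag)

  Word : Set
  Word = List Bool

  trues : Word → ℕ
  trues []          = 0
  trues (true ∷ w)  = suc (trues w)
  trues (false ∷ w) = trues w

  falses : Word → ℕ
  falses []          = 0
  falses (true ∷ w)  = falses w
  falses (false ∷ w) = suc (falses w)

  trues-++ : ∀ xs ys → trues (xs ++ ys) ≡ trues xs + trues ys
  trues-++ []          ys = refl
  trues-++ (true ∷ xs) ys = cong suc (trues-++ xs ys)
  trues-++ (false ∷ xs) ys = trues-++ xs ys

  falses-++ : ∀ xs ys → falses (xs ++ ys) ≡ falses xs + falses ys
  falses-++ []           ys = refl
  falses-++ (true ∷ xs)  ys = falses-++ xs ys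
  falses-++ (false ∷ xs) ys = cong suc (falses-++ xs ys)

  length≡trues+falses : ∀ w → length w ≡ trues w + falses w
  length≡trues+falses []          = refl
  length≡trues+falses (true ∷ w)  = cong suc (length≡trues+falses w)
  length≡trues+falses (false ∷ w) = trans (cong suc (length≡trues+falses w)) (sym (+-suc (trues w) (falses w)))

  trues≤length : ∀ w → trues w ≤ length w
  trues≤length w = subst (trues w ≤_) (sym (length≡trues+falses w)) (m≤m+n (trues w) (falses w))

  words : ℕ → ℕ → List Word
  words zero    zero    = [] ∷ []
  words zero    (suc b) = map (false ∷_) (words zero b)
  words (suc a) zero    = map (true ∷_) (words a zero)
  words (suc a) (suc b) = map (true ∷_) (words a (suc b)) ++ map (false ∷_) (words (suc a) b)

  ∈-words : ∀ w → w ∈ words (trues w) (falses w)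
  ∈-words [] = here refl
  ∈-words (true ∷ w) with falses w | ∈-words w
  ... | zero  | m = ∈-map⁺ (true ∷_) m
  ... | suc b | m = ∈-++⁺ˡ (∈-map⁺ (true ∷_) m)
  ∈-words (false ∷ w) with trues w | ∈-words w
  ... | zero  | m = ∈-map⁺ (false ∷_) m
  ... | suc a | m = ∈-++⁺ʳ (map (true ∷_) (words a (suc (falses w)))) (∈-map⁺ (false ∷_) m)

  ∈-words⁺ : ∀ {w a b} → trues w ≡ a → falses w ≡ b → w ∈ words a b
  ∈-words⁺ {w} refl refl = ∈-words w

  ∈-words⁻ : ∀ a b {w} → w ∈ words a b → trues w ≡ a × falses w ≡ b
  ∈-words⁻ zero zero (here refl) = refl , refl
  ∈-words⁻ zero (suc b) m with ∈-map⁻ (false ∷_) m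
  ... | v , mv , refl = let (t , f) = ∈-words⁻ zero b mv in t , cong suc f
  ∈-words⁻ (suc a) zero m with ∈-map⁻ (true ∷_) m
  ... | v , mv , refl = let (t , f) = ∈-words⁻ a zero mv in cong suc t , f
  ∈-words⁻ (suc a) (suc b) m with ∈-++⁻ (map (true ∷_) (words a (suc b))) m
  ... | inj₁ m₁ with ∈-map⁻ (true ∷_) m₁
  ... | v , mv , refl = let (t , f) = ∈-words⁻ a (suc b) mv in cong suc t , f
  ∈-words⁻ (suc a) (suc b) m | inj₂ m₂ with ∈-map⁻ (false ∷_) m₂
  ... | v , mv , refl = let (t , f) = ∈-words⁻ (suc a) b mv in t , cong suc f

  length-balanced : ∀ {n w} → w ∈ words n n → length w ≡ 2 * n
  length-balanced {n} {w} m =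
    trans (length≡trues+falses w)
      (trans (cong₂ _+_ (proj₁ (∈-words⁻ n n m)) (proj₂ (∈-words⁻ n n m))) (cong (n +_) (sym (+-identityʳ n))))

  words-unique : ∀ a b → Unique (words a b)
  words-unique zero    zero    = All.[] ∷ []
  words-unique zero    (suc b) = Unique.map⁺ ∷-injectiveʳ (words-unique zero b)
  words-unique (suc a) zero    = Unique.map⁺ ∷-injectiveʳ (words-unique a zero)
  words-unique (suc a) (suc b) =
    Unique.++⁺ (Unique.map⁺ ∷-injectiveʳ (words-unique a (suc b)))
               (Unique.map⁺ ∷-injectiveʳ (words-unique (suc a) b)) disjoint
    where
    disjoint : ∀ {v} → v ∈ map (true ∷_) (words a (suc b)) × v ∈ map (false ∷_) (words (suc a) b) → ⊥
    disjoint (m₁ , m₂) with ∈-map⁻ (true ∷_) m₁ | ∈-map⁻ (false ∷_) m₂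
    ... | _ , _ , refl | _ , _ , ()

  length-words : ∀ a b → length (words a b) ≡ binom (a + b) a
  length-words zero    zero    = refl
  length-words zero    (suc b) = trans (length-map _ (words zero b)) (length-words zero b)
  length-words (suc a) zero    = begin
    length (map (true ∷_) (words a zero))  ≡⟨ length-map _ (words a zero) ⟩
    length (words a zero)                  ≡⟨ length-words a zero ⟩
    binom (a + zero) a                     ≡⟨ cong (λ m → binom m a) (+-identityʳ a) ⟩
    binom a a                              ≡⟨ trans (binom-diag a) (sym (binom-diag (suc a))) ⟩
    binom (suc a) (suc a)                  ≡⟨ cong (λ m → binom m (suc a)) (+-identityʳ (suc a)) ⟨
    binom (suc a + zero) (suc a)           ∎
    where open ≡-Reasoning
  length-words (suc a) (suc b) = trans (length-++ (map (true ∷_) (words a (suc b))))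
    (cong₂ _+_ (trans (length-map _ (words a (suc b))) (length-words a (suc b)))
               (trans (length-map _ (words (suc a) b))
                 (trans (length-words (suc a) b) (cong (λ m → binom m (suc a)) (sym (+-suc a b))))))

-- Read a word as a walk; at state (t, s) it has made t up
-- steps and s down steps.  A down step taken at a state with t ≤ s (from
-- height ≤ 0) is a *flaw*.  For balanced words with n steps of each kind
-- the flaw count j ranges over 0…n, and each value is attained equally
-- often: `removeFlaw` and `addFlaw` are inverse bijections between words
-- with j+1 and j flaws.  If w = u ↓ p ↑ q, where u ↓ is the first descent
-- below the starting level and p ↑ the first return after it, then
-- removeFlaw w = p ↑ u ↓ q.
module ChungFeller where

  open import Data.Bool using (Bool; true; false)
  open import Data.Nat using (ℕ; zero; suc; _+_; _*_; _≤_; _<_; _≤ᵇ_; _≡ᵇ_; z≤n; s≤s; z<s)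
  open import Data.Nat.Properties
  open import Data.List using (List; []; _∷_; _++_; map; length; filterᵇ)
  open import Data.Nat.ListAction using (sum)
  open import Data.List.Membership.Propositional using (_∈_)
  open import Data.Maybe using (Maybe; just; nothing)
  open import Data.Product using (_×_; _,_; proj₁; proj₂)
  open import Data.Empty using (⊥-elim)
  open import Relation.Binary.PropositionalEquality
  open import Data.Nat.Solver using (module +-*-Solver)
  open +-*-Solver
  open BooleanTests using (≤ᵇ-true; ≤ᵇ-false; ≤ᵇ-shift; ≡ᵇ-sound; ≡ᵇ-refl)
  open ListCounting
    using (indicator; count-bijection; sum-by-value; sumBelow; sumBelow-cong; sumBelow-const)
  open Binomials using (binom)
  open LatticeWords

  flaws : ℕ → ℕ → Word → ℕ
  flaws t s []          = 0
  flaws t s (true ∷ w)  = flaws (suc t) s w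
  flaws t s (false ∷ w) = indicator (t ≤ᵇ s) + flaws t (suc s) w

  flaws-++ : ∀ t s xs ys →
    flaws t s (xs ++ ys) ≡ flaws t s xs + flaws (trues xs + t) (falses xs + s) ys
  flaws-++ t s [] ys = refl
  flaws-++ t s (true ∷ xs) ys =
    trans (flaws-++ (suc t) s xs ys)
          (cong (λ z → flaws (suc t) s xs + flaws z (falses xs + s) ys) (+-suc (trues xs) t))
  flaws-++ t s (false ∷ xs) ys =
    trans (cong (indicator (t ≤ᵇ s) +_)
            (trans (flaws-++ t (suc s) xs ys)
                   (cong (λ z → flaws t (suc s) xs + flaws (trues xs + t) z ys) (+-suc (falses xs) s))))
          (sym (+-assoc (indicator (t ≤ᵇ s)) _ _))

  flaws-shift : ∀ c t s w → flaws (c + t) (c + s) w ≡ flaws t s w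
  flaws-shift c t s [] = refl
  flaws-shift c t s (true ∷ w) =
    trans (cong (λ z → flaws z (c + s) w) (sym (+-suc c t))) (flaws-shift c (suc t) s w)
  flaws-shift c t s (false ∷ w) = cong₂ _+_ (cong indicator (≤ᵇ-shift c t s))
    (trans (cong (λ z → flaws (c + t) z w) (sym (+-suc c s))) (flaws-shift c t (suc s) w))

  flaws-diag : ∀ c w → flaws c c w ≡ flaws 0 0 w
  flaws-diag c w =
    trans (cong₂ (λ a b → flaws a b w) (sym (+-identityʳ c)) (sym (+-identityʳ c))) (flaws-shift c 0 0 w)

  flaws≤falses : ∀ t s w → flaws t s w ≤ falses w
  flaws≤falses t s [] = z≤n
  flaws≤falses t s (true ∷ w) = flaws≤falses (suc t) s w
  flaws≤falses t s (false ∷ w) with t ≤ᵇ s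
  ... | true  = s≤s (flaws≤falses t (suc s) w)
  ... | false = ≤-trans (flaws≤falses t (suc s) w) (n≤1+n _)

  Split : Set
  Split = Maybe (Word × Word)

  prepend : Bool → Split → Split
  prepend b nothing        = nothing
  prepend b (just (u , r)) = just (b ∷ u , r)

  -- firstDescent h w splits w = u ↓ r at the first down step that leaves
  -- height 0, the walk starting at height h.
  firstDescent : ℕ → Word → Split
  firstDescent h       []          = nothing
  firstDescent h       (true ∷ w)  = prepend true (firstDescent (suc h) w)
  firstDescent zero    (false ∷ w) = just ([] , w)
  firstDescent (suc h) (false ∷ w) = prepend false (firstDescent h w)

  -- firstAscent d w splits w = p ↑ q at the first up step that leaves
  -- depth 0, the walk starting at depth d.
  firstAscent : ℕ → Word → Split
  firstAscent d       []          = nothing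
  firstAscent d       (false ∷ w) = prepend false (firstAscent (suc d) w)
  firstAscent zero    (true ∷ w)  = just ([] , w)
  firstAscent (suc d) (true ∷ w)  = prepend true (firstAscent d w)

  -- What a successful descent split records: the shape of w, the height
  -- balance of the prefix u, that u has no flaws above level h, and that
  -- the split only looks at u ↓.
  record Descent (h : ℕ) (w u r : Word) : Set where
    constructor descent
    field
      shape    : w ≡ u ++ false ∷ r
      balance  : trues u + h ≡ falses u
      flawless : ∀ s c → flaws (s + (h + c)) s u ≡ 0
      local    : ∀ r′ → firstDescent h (u ++ false ∷ r′) ≡ just (u , r′)

  record Ascent (d : ℕ) (w p q : Word) : Set where
    constructor ascent
    field
      shape    : w ≡ p ++ true ∷ q
      balance  : trues p ≡ d + falses p
      allFlaws : ∀ t c → flaws t (t + (d + c)) p ≡ falses p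
      local    : ∀ q′ → firstAscent d (p ++ true ∷ q′) ≡ just (p , q′)

  descent-split : ∀ h w u r → firstDescent h w ≡ just (u , r) → Descent h w u r
  descent-split h [] u r ()
  descent-split h (true ∷ w) u r e with firstDescent (suc h) w in eq
  descent-split h (true ∷ w) u r () | nothing
  descent-split h (true ∷ w) .(true ∷ u′) .r′ refl | just (u′ , r′)
    with descent shape bal fl loc ← descent-split (suc h) w u′ r′ eq =
    descent (cong (true ∷_) shape) (trans (sym (+-suc (trues u′) h)) bal)
      (λ s c → trans (cong (λ z → flaws z s u′) (sym (+-suc s (h + c)))) (fl s c))
      (λ r″ → cong (prepend true) (loc r″))
  descent-split zero (false ∷ w) .[] .w refl = descent refl refl (λ s c → refl) (λ r′ → refl)
  descent-split (suc h) (false ∷ w) u r e with firstDescent h w in eq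
  descent-split (suc h) (false ∷ w) u r () | nothing
  descent-split (suc h) (false ∷ w) .(false ∷ u′) .r′ refl | just (u′ , r′)
    with descent shape bal fl loc ← descent-split h w u′ r′ eq =
    descent (cong (false ∷_) shape) (trans (+-suc (trues u′) h) (cong suc bal))
      (λ s c → cong₂ _+_ (cong indicator (≤ᵇ-false (m<m+n s z<s)))
         (trans (cong (λ z → flaws z (suc s) u′) (+-suc s (h + c))) (fl (suc s) c)))
      (λ r″ → cong (prepend false) (loc r″))

  ascent-split : ∀ d w p q → firstAscent d w ≡ just (p , q) → Ascent d w p q
  ascent-split d [] p q ()
  ascent-split d (false ∷ w) p q e with firstAscent (suc d) w in eq
  ascent-split d (false ∷ w) p q () | nothing
  ascent-split d (false ∷ w) .(false ∷ p′) .q′ refl | just (p′ , q′)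
    with ascent shape bal fl loc ← ascent-split (suc d) w p′ q′ eq =
    ascent (cong (false ∷_) shape) (trans bal (sym (+-suc d (falses p′))))
      (λ t c → cong₂ _+_ (cong indicator (≤ᵇ-true (m≤m+n t (d + c))))
         (trans (cong (λ z → flaws t z p′) (sym (+-suc t (d + c)))) (fl t c)))
      (λ q″ → cong (prepend false) (loc q″))
  ascent-split zero (true ∷ w) .[] .w refl = ascent refl refl (λ t c → refl) (λ q′ → refl)
  ascent-split (suc d) (true ∷ w) p q e with firstAscent d w in eq
  ascent-split (suc d) (true ∷ w) p q () | nothing
  ascent-split (suc d) (true ∷ w) .(true ∷ p′) .q′ refl | just (p′ , q′)
    with ascent shape bal fl loc ← ascent-split d w p′ q′ eq =
    ascent (cong (true ∷_) shape) (cong suc bal)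
      (λ t c → trans (cong (λ z → flaws (suc t) z p′) (+-suc t (d + c))) (fl (suc t) c))
      (λ q″ → cong (prepend true) (loc q″))

  no-descent : ∀ h w → firstDescent h w ≡ nothing →
    (∀ s c → flaws (s + (h + c)) s w ≡ 0) × (falses w ≤ h + trues w)
  no-descent h [] e = (λ s c → refl) , z≤n
  no-descent h (true ∷ w) e with firstDescent (suc h) w in eq
  no-descent h (true ∷ w) () | just _
  ... | nothing with no-descent (suc h) w eq
  ... | fl , hi =
    (λ s c → trans (cong (λ z → flaws z s w) (sym (+-suc s (h + c)))) (fl s c)) ,
    ≤-trans hi (≤-reflexive (sym (+-suc h (trues w))))
  no-descent zero (false ∷ w) ()
  no-descent (suc h) (false ∷ w) e with firstDescent h w in eq
  no-descent (suc h) (false ∷ w) () | just _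
  ... | nothing with no-descent h w eq
  ... | fl , hi =
    (λ s c → cong₂ _+_ (cong indicator (≤ᵇ-false (m<m+n s z<s)))
               (trans (cong (λ z → flaws z (suc s) w) (+-suc s (h + c))) (fl (suc s) c))) ,
    s≤s hi

  no-ascent : ∀ d w → firstAscent d w ≡ nothing →
    (∀ t c → flaws t (t + (d + c)) w ≡ falses w) × (trues w ≤ d + falses w)
  no-ascent d [] e = (λ t c → refl) , z≤n
  no-ascent d (false ∷ w) e with firstAscent (suc d) w in eq
  no-ascent d (false ∷ w) () | just _
  ... | nothing with no-ascent (suc d) w eq
  ... | fl , lo =
    (λ t c → cong₂ _+_ (cong indicator (≤ᵇ-true (m≤m+n t (d + c))))
               (trans (cong (λ z → flaws t z w) (sym (+-suc t (d + c)))) (fl t c))) ,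
    ≤-trans lo (≤-reflexive (sym (+-suc d (falses w))))
  no-ascent zero (true ∷ w) ()
  no-ascent (suc d) (true ∷ w) e with firstAscent d w in eq
  no-ascent (suc d) (true ∷ w) () | just _
  ... | nothing with no-ascent d w eq
  ... | fl , lo = (λ t c → trans (cong (λ z → flaws (suc t) z w) (+-suc t (d + c))) (fl (suc t) c)) , s≤s lo

  descent-balanced : ∀ {w u r} → Descent 0 w u r → trues u ≡ falses u
  descent-balanced {u = u} d = trans (sym (+-identityʳ (trues u))) (Descent.balance d)

  -- Flaws of u ↓ p ↑ q: none in u, the step ↓, all of p, then those of q.
  flaws-descent-first : ∀ {w₁ w₂ r₁ r₂} u p q → Descent 0 w₁ u r₁ → Ascent 0 w₂ p r₂ →
    flaws 0 0 (u ++ false ∷ p ++ true ∷ q) ≡ suc (falses p + flaws 0 0 q)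
  flaws-descent-first u p q du ap = begin
    flaws 0 0 (u ++ false ∷ p ++ true ∷ q)
      ≡⟨ flaws-++ 0 0 u (false ∷ p ++ true ∷ q) ⟩
    flaws 0 0 u + flaws (trues u + 0) (falses u + 0) (false ∷ p ++ true ∷ q)
      ≡⟨ cong₂ _+_ (Descent.flawless du 0 0)
                  (cong (λ z → flaws (z + 0) X (false ∷ p ++ true ∷ q)) (descent-balanced du)) ⟩
    indicator (X ≤ᵇ X) + flaws X (suc X) (p ++ true ∷ q)
      ≡⟨ cong₂ _+_ (cong indicator (≤ᵇ-true (≤-refl {X}))) (flaws-++ X (suc X) p (true ∷ q)) ⟩
    suc (flaws X (suc X) p + flaws (suc (trues p + X)) (falses p + suc X) q)
      ≡⟨ cong suc (cong₂ _+_ p-flaws q-flaws) ⟩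
    suc (falses p + flaws 0 0 q)
      ∎
    where
    open ≡-Reasoning
    X = falses u + 0
    p-flaws : flaws X (suc X) p ≡ falses p
    p-flaws = trans (cong (λ z → flaws X z p) (+-comm 1 X)) (Ascent.allFlaws ap X 1)
    q-flaws : flaws (suc (trues p + X)) (falses p + suc X) q ≡ flaws 0 0 q
    q-flaws = trans (cong (λ z → flaws (suc (z + X)) (falses p + suc X) q) (Ascent.balance ap))
                (trans (cong (λ z → flaws z (falses p + suc X) q) (sym (+-suc (falses p) X)))
                  (flaws-diag (falses p + suc X) q))

  -- Flaws of p ↑ u ↓ q: all of p, then none until q.
  flaws-ascent-first : ∀ {w₁ w₂ r₁ r₂} u p q → Descent 0 w₁ u r₁ → Ascent 0 w₂ p r₂ →
    flaws 0 0 (p ++ true ∷ u ++ false ∷ q) ≡ falses p + flaws 0 0 q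
  flaws-ascent-first u p q du ap = begin
    flaws 0 0 (p ++ true ∷ u ++ false ∷ q)
      ≡⟨ flaws-++ 0 0 p (true ∷ u ++ false ∷ q) ⟩
    flaws 0 0 p + flaws (suc (trues p + 0)) Y (u ++ false ∷ q)
      ≡⟨ cong₂ _+_ (Ascent.allFlaws ap 0 0) (cong (λ z → flaws (suc (z + 0)) Y (u ++ false ∷ q)) (Ascent.balance ap)) ⟩
    falses p + flaws (suc Y) Y (u ++ false ∷ q)
      ≡⟨ cong (falses p +_) (flaws-++ (suc Y) Y u (false ∷ q)) ⟩
    falses p + (flaws (suc Y) Y u + flaws (trues u + suc Y) (falses u + Y) (false ∷ q))
      ≡⟨ cong (λ z → falses p + (z + flaws (trues u + suc Y) (falses u + Y) (false ∷ q))) u-flaws ⟩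
    falses p + flaws (trues u + suc Y) (falses u + Y) (false ∷ q)
      ≡⟨ cong (λ z → falses p + flaws (z + suc Y) (falses u + Y) (false ∷ q)) (descent-balanced du) ⟩
    falses p + (indicator (Z + suc Y ≤ᵇ Z + Y) + flaws (Z + suc Y) (suc (Z + Y)) q)
      ≡⟨ cong (falses p +_) (cong₂ _+_ (cong indicator (≤ᵇ-false (+-monoʳ-< Z (n<1+n Y)))) q-flaws) ⟩
    falses p + flaws 0 0 q
      ∎
    where
    open ≡-Reasoning
    Y = falses p + 0
    Z = falses u
    u-flaws : flaws (suc Y) Y u ≡ 0
    u-flaws = trans (cong (λ z → flaws z Y u) (+-comm 1 Y)) (Descent.flawless du Y 1)
    q-flaws : flaws (Z + suc Y) (suc (Z + Y)) q ≡ flaws 0 0 q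
    q-flaws = trans (cong (λ z → flaws z (suc (Z + Y)) q) (+-suc Z Y)) (flaws-diag (suc (Z + Y)) q)

  trues-exchange : ∀ u p q → trues (u ++ false ∷ p ++ true ∷ q) ≡ trues (p ++ true ∷ u ++ false ∷ q)
  trues-exchange u p q = begin
    trues (u ++ false ∷ p ++ true ∷ q)   ≡⟨ trues-++ u (false ∷ p ++ true ∷ q) ⟩
    trues u + trues (p ++ true ∷ q)      ≡⟨ cong (trues u +_) (trues-++ p (true ∷ q)) ⟩
    trues u + (trues p + suc (trues q))
      ≡⟨ solve 3 (λ a b c → a :+ (b :+ (con 1 :+ c)) := b :+ (con 1 :+ (a :+ c))) refl (trues u) (trues p) (trues q) ⟩
    trues p + suc (trues u + trues q)    ≡⟨ cong (λ z → trues p + suc z) (trues-++ u (false ∷ q)) ⟨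
    trues p + trues (true ∷ u ++ false ∷ q) ≡⟨ trues-++ p (true ∷ u ++ false ∷ q) ⟨
    trues (p ++ true ∷ u ++ false ∷ q)   ∎
    where open ≡-Reasoning

  falses-exchange : ∀ u p q → falses (u ++ false ∷ p ++ true ∷ q) ≡ falses (p ++ true ∷ u ++ false ∷ q)
  falses-exchange u p q = begin
    falses (u ++ false ∷ p ++ true ∷ q)   ≡⟨ falses-++ u (false ∷ p ++ true ∷ q) ⟩
    falses u + suc (falses (p ++ true ∷ q)) ≡⟨ cong (λ z → falses u + suc z) (falses-++ p (true ∷ q)) ⟩
    falses u + suc (falses p + falses q)
      ≡⟨ solve 3 (λ a b c → a :+ (con 1 :+ (b :+ c)) := b :+ (a :+ (con 1 :+ c))) refl (falses u) (falses p) (falses q) ⟩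
    falses p + (falses u + suc (falses q)) ≡⟨ cong (falses p +_) (falses-++ u (false ∷ q)) ⟨
    falses p + falses (u ++ false ∷ q)    ≡⟨ falses-++ p (true ∷ u ++ false ∷ q) ⟨
    falses (p ++ true ∷ u ++ false ∷ q)   ∎
    where open ≡-Reasoning

  moveAscentFirst : Word → Word → Split → Word
  moveAscentFirst w u nothing        = w
  moveAscentFirst w u (just (p , q)) = p ++ true ∷ u ++ false ∷ q

  removeFlawAt : Word → Split → Word
  removeFlawAt w nothing        = w
  removeFlawAt w (just (u , r)) = moveAscentFirst w u (firstAscent 0 r)

  removeFlaw : Word → Word
  removeFlaw w = removeFlawAt w (firstDescent 0 w)

  -- addFlaw (p ↑ u ↓ q) = u ↓ p ↑ q, where p ↑ is the first ascent and
  -- u ↓ the first descent after it.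
  moveDescentFirst : Word → Word → Split → Word
  moveDescentFirst w p nothing        = w
  moveDescentFirst w p (just (u , q)) = u ++ false ∷ p ++ true ∷ q

  addFlawAt : Word → Split → Word
  addFlawAt w nothing        = w
  addFlawAt w (just (p , r)) = moveDescentFirst w p (firstDescent 0 r)

  addFlaw : Word → Word
  addFlaw w = addFlawAt w (firstAscent 0 w)

  removeFlaw-spec : ∀ w j → trues w ≡ falses w → flaws 0 0 w ≡ suc j →
    (trues (removeFlaw w) ≡ trues w) × (falses (removeFlaw w) ≡ falses w) ×
    (flaws 0 0 (removeFlaw w) ≡ j) × (addFlaw (removeFlaw w) ≡ w)
  removeFlaw-spec w j bal fj with firstDescent 0 w in e₁
  ... | nothing = ⊥-elim (0≢1+n (trans (sym (proj₁ (no-descent 0 w e₁) 0 0)) fj))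
  ... | just (u , r) with descent-split 0 w u r e₁
  ... | du@(descent refl _ _ localᵘ) with firstAscent 0 r in e₂
  ... | nothing = ⊥-elim (<-irrefl refl (≤-trans (≤-reflexive r-low) (proj₂ (no-ascent 0 r e₂))))
    where
    -- after u ↓ the walk sits one below 0 and must still end at 0
    r-low : suc (falses r) ≡ trues r
    r-low = +-cancelˡ-≡ (falses u) _ _ (begin
      falses u + suc (falses r)  ≡⟨ falses-++ u (false ∷ r) ⟨
      falses (u ++ false ∷ r)    ≡⟨ bal ⟨
      trues (u ++ false ∷ r)     ≡⟨ trues-++ u (false ∷ r) ⟩
      trues u + trues r          ≡⟨ cong (_+ trues r) (descent-balanced du) ⟩
      falses u + trues r         ∎)
      where open ≡-Reasoning
  ... | just (p , q) with ascent-split 0 r p q e₂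
  ... | ap@(ascent refl _ _ localᵖ) =
    sym (trues-exchange u p q) , sym (falses-exchange u p q) ,
    suc-injective (trans (cong suc (flaws-ascent-first u p q du ap)) (trans (sym (flaws-descent-first u p q du ap)) fj)) ,
    inverse
    where
    inverse : addFlaw (p ++ true ∷ u ++ false ∷ q) ≡ u ++ false ∷ p ++ true ∷ q
    inverse rewrite localᵖ (u ++ false ∷ q) | localᵘ q = refl

  addFlaw-spec : ∀ w j → trues w ≡ falses w → flaws 0 0 w ≡ j → j < falses w →
    (trues (addFlaw w) ≡ trues w) × (falses (addFlaw w) ≡ falses w) ×
    (flaws 0 0 (addFlaw w) ≡ suc j) × (removeFlaw (addFlaw w) ≡ w)
  addFlaw-spec w j bal fj j< with firstAscent 0 w in e₁
  ... | nothing = ⊥-elim (<-irrefl (trans (sym fj) (proj₁ (no-ascent 0 w e₁) 0 0)) j<)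
  ... | just (p , r) with ascent-split 0 w p r e₁
  ... | ap@(ascent refl balᵖ _ localᵖ) with firstDescent 0 r in e₂
  ... | nothing = ⊥-elim (<-irrefl refl (≤-trans (≤-reflexive r-high) (proj₂ (no-descent 0 r e₂))))
    where
    -- after p ↑ the walk sits one above 0 and must still end at 0
    r-high : suc (trues r) ≡ falses r
    r-high = +-cancelˡ-≡ (falses p) _ _ (begin
      falses p + suc (trues r)  ≡⟨ cong (_+ suc (trues r)) balᵖ ⟨
      trues p + suc (trues r)   ≡⟨ trues-++ p (true ∷ r) ⟨
      trues (p ++ true ∷ r)     ≡⟨ bal ⟩
      falses (p ++ true ∷ r)    ≡⟨ falses-++ p (true ∷ r) ⟩
      falses p + falses r       ∎)
      where open ≡-Reasoning
  ... | just (u , q) with descent-split 0 r u q e₂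
  ... | du@(descent refl _ _ localᵘ) =
    trues-exchange u p q , falses-exchange u p q ,
    trans (flaws-descent-first u p q du ap) (cong suc (trans (sym (flaws-ascent-first u p q du ap)) fj)) ,
    inverse
    where
    inverse : removeFlaw (u ++ false ∷ p ++ true ∷ q) ≡ p ++ true ∷ u ++ false ∷ q
    inverse rewrite localᵘ (p ++ true ∷ q) | localᵖ q = refl

  wordsWithFlaws : ℕ → ℕ → ℕ
  wordsWithFlaws n j = length (filterᵇ (λ w → flaws 0 0 w ≡ᵇ j) (words n n))

  flaws-bound : ∀ n {w} → w ∈ words n n → flaws 0 0 w < suc n
  flaws-bound n {w} m = s≤s (≤-trans (flaws≤falses 0 0 w) (≤-reflexive (proj₂ (∈-words⁻ n n m))))

  wordsWithFlaws-step : ∀ n j → j < n → wordsWithFlaws n (suc j) ≡ wordsWithFlaws n j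
  wordsWithFlaws-step n j j<n =
    count-bijection (words n n) (words n n) (λ w → flaws 0 0 w ≡ᵇ suc j) (λ w → flaws 0 0 w ≡ᵇ j)
      removeFlaw addFlaw (words-unique n n) (words-unique n n) forth back
    where
    forth : ∀ {w} → w ∈ words n n → (flaws 0 0 w ≡ᵇ suc j) ≡ true →
      (removeFlaw w ∈ words n n) × ((flaws 0 0 (removeFlaw w) ≡ᵇ j) ≡ true) × (addFlaw (removeFlaw w) ≡ w)
    forth {w} m e with ∈-words⁻ n n m
    ... | t , f with removeFlaw-spec w j (trans t (sym f)) (≡ᵇ-sound _ _ e)
    ... | t′ , f′ , fl , inv =
      ∈-words⁺ (trans t′ t) (trans f′ f) , subst (λ z → (z ≡ᵇ j) ≡ true) (sym fl) (≡ᵇ-refl j) , inv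
    back : ∀ {w} → w ∈ words n n → (flaws 0 0 w ≡ᵇ j) ≡ true →
      (addFlaw w ∈ words n n) × ((flaws 0 0 (addFlaw w) ≡ᵇ suc j) ≡ true) × (removeFlaw (addFlaw w) ≡ w)
    back {w} m e with ∈-words⁻ n n m
    ... | t , f with addFlaw-spec w j (trans t (sym f)) (≡ᵇ-sound _ _ e) (subst (j <_) (sym f) j<n)
    ... | t′ , f′ , fl , inv =
      ∈-words⁺ (trans t′ t) (trans f′ f) , subst (λ z → (z ≡ᵇ suc j) ≡ true) (sym fl) (≡ᵇ-refl (suc j)) , inv

  chung-feller : ∀ n j → j ≤ n → wordsWithFlaws n j ≡ wordsWithFlaws n 0
  chung-feller n zero    _ = refl
  chung-feller n (suc j) p = trans (wordsWithFlaws-step n j p) (chung-feller n j (≤-trans (n≤1+n j) p))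

  chung-feller-total : ∀ n → suc n * wordsWithFlaws n 0 ≡ binom (n + n) n
  chung-feller-total n = sym (begin
    binom (n + n) n
      ≡⟨ length-words n n ⟨
    length (words n n)
      ≡⟨ length-as-sum (words n n) ⟩
    sum (map (λ w → 1) (words n n))
      ≡⟨ sum-by-value (flaws 0 0) (λ _ → 1) (suc n) (words n n) (flaws-bound n) ⟩
    sumBelow (λ j → wordsWithFlaws n j * 1) (suc n)
      ≡⟨ sumBelow-cong _ _ (suc n) (λ j p → cong (_* 1) (chung-feller n j (≤-pred p))) ⟩
    sumBelow (λ _ → wordsWithFlaws n 0 * 1) (suc n)
      ≡⟨ sumBelow-const _ (suc n) ⟩
    suc n * (wordsWithFlaws n 0 * 1)
      ≡⟨ cong (suc n *_) (*-identityʳ _) ⟩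
    suc n * wordsWithFlaws n 0
      ∎)
    where
    open ≡-Reasoning
    length-as-sum : ∀ {A : Set} (xs : List A) → length xs ≡ sum (map (λ _ → 1) xs)
    length-as-sum [] = refl
    length-as-sum (x ∷ xs) = cong suc (length-as-sum xs)

-- A list b of flags marks rows that
-- must carry a wall; among the k-subsets of the n rows, those containing
-- all flagged rows number C(n − j, k − j), j being the number of flags.
module WallSets where

  open import Data.Bool using (Bool; true; false; not; _∧_; _∨_)
  open import Data.Bool.Properties using (∧-zeroʳ)
  open import Data.Nat using (ℕ; zero; suc; _+_; _≡ᵇ_)
  open import Data.Nat.Properties using (suc-injective; ≤-trans; ≤-reflexive; +-identityʳ)
  open import Data.List using (List; []; _∷_; _++_; map; length; filterᵇ)
  open import Data.Vec using ([]; _∷_)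
  open import Data.Fin.Subset using (Subset; ∣_∣)
  open import Relation.Binary.PropositionalEquality
  open ListCounting
  open Binomials using (supersets; supersetsWith; supersets-fixed; supersets-free)
  open LatticeWords using (trues; trues≤length)

  containsFlagged : ∀ {n} → Subset n → List Bool → Bool
  containsFlagged []      _       = true
  containsFlagged (x ∷ W) []      = true
  containsFlagged (x ∷ W) (y ∷ b) = (x ∨ not y) ∧ containsFlagged W b

  sides : List Bool
  sides = true ∷ false ∷ []

  containing : ℕ → ℕ → List Bool → ℕ
  containing n k b = length (filterᵇ (λ W → (∣ W ∣ ≡ᵇ k) ∧ containsFlagged W b) (allVecs sides n))

  -- The same count restricted to sets with a wall in a new first row.
  containingWithFirst : ℕ → ℕ → List Bool → ℕ
  containingWithFirst n k b = length (filterᵇ (λ W → (suc ∣ W ∣ ≡ᵇ k) ∧ containsFlagged W b) (allVecs sides n))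

  containing-split : ∀ n k y b → containing (suc n) k (y ∷ b) ≡
    containingWithFirst n k b +
    length (filterᵇ (λ W → (∣ W ∣ ≡ᵇ k) ∧ (not y ∧ containsFlagged W b)) (allVecs sides n))
  containing-split n k y b =
    trans (length-filterᵇ-++ _ (map (true ∷_) (allVecs sides n)) (map (false ∷_) (allVecs sides n) ++ []))
      (cong₂ _+_ (length-filterᵇ-map _ (true ∷_) (allVecs sides n))
        (trans (length-filterᵇ-++ _ (map (false ∷_) (allVecs sides n)) [])
          (trans (+-identityʳ _) (length-filterᵇ-map _ (false ∷_) (allVecs sides n)))))

  containing≡supersets : ∀ n k b → length b ≡ n → containing n k b ≡ supersets n k (trues b)
  containingWithFirst≡supersetsWith : ∀ n k b → length b ≡ n →
    containingWithFirst n k b ≡ supersetsWith n k (trues b)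

  containing≡supersets zero zero    [] refl = refl
  containing≡supersets zero (suc k) [] refl = refl
  containing≡supersets (suc n) k (true ∷ b) e = begin
    containing (suc n) k (true ∷ b)
      ≡⟨ containing-split n k true b ⟩
    containingWithFirst n k b + length (filterᵇ (λ W → (∣ W ∣ ≡ᵇ k) ∧ false) (allVecs sides n))
      ≡⟨ cong₂ _+_ (containingWithFirst≡supersetsWith n k b (suc-injective e))
                   (length-filterᵇ-none _ (allVecs sides n) (λ W → ∧-zeroʳ _)) ⟩
    supersetsWith n k (trues b) + 0
      ≡⟨ +-identityʳ _ ⟩
    supersetsWith n k (trues b)
      ≡⟨ supersets-fixed n k (trues b) ⟨
    supersets (suc n) k (suc (trues b))
      ∎
    where open ≡-Reasoning
  containing≡supersets (suc n) k (false ∷ b) e = begin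
    containing (suc n) k (false ∷ b)
      ≡⟨ containing-split n k false b ⟩
    containingWithFirst n k b + containing n k b
      ≡⟨ cong₂ _+_ (containingWithFirst≡supersetsWith n k b (suc-injective e))
                   (containing≡supersets n k b (suc-injective e)) ⟩
    supersetsWith n k (trues b) + supersets n k (trues b)
      ≡⟨ supersets-free n k (trues b) (≤-trans (trues≤length b) (≤-reflexive (suc-injective e))) ⟨
    supersets (suc n) k (trues b)
      ∎
    where open ≡-Reasoning

  containingWithFirst≡supersetsWith n zero    b e = length-filterᵇ-none _ (allVecs sides n) (λ W → refl)
  containingWithFirst≡supersetsWith n (suc k) b e = containing≡supersets n k b e

  wallSets-containing : ∀ n k (b : List Bool) → length b ≡ n →
    length (filterᵇ (λ W → containsFlagged W b) (subsetsOfSize n k)) ≡ supersets n k (trues b)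
  wallSets-containing n k b e =
    trans (length-filterᵇ-filterᵇ _ _ (allVecs sides n)) (containing≡supersets n k b e)

-- A word w of length L is the same thing as a splitting of the labels
-- c, …, c+L−1 into two ascending lists: the positions of its trues and of
-- its falses.
module Positions where

  open import Data.Bool using (Bool; true; false; not; if_then_else_; _∨_)
  open import Data.Nat using (ℕ; zero; suc; _+_; _≤_; _<_; z≤n; s≤s; _≡ᵇ_)
  open import Data.Nat.Properties
  open import Data.List using (List; []; _∷_; map; length; filterᵇ)
  open import Data.Bool.ListAction using (any)
  open import Data.Product using (_×_; _,_; Σ)
  open import Data.Sum using (_⊎_; inj₁; inj₂)
  open import Data.Empty using (⊥; ⊥-elim)
  open import Function using (id)
  open import Relation.Binary.PropositionalEquality
  open import Data.List.Membership.Propositional using (_∈_)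
  open import Data.List.Relation.Unary.Any using (here; there)
  open import Data.List.Relation.Unary.All using (All; []; _∷_)
  import Data.List.Relation.Unary.All as All
  open BooleanTests
  open ListCounting using (any-elim; any-intro; filterᵇ-accept; filterᵇ-reject)
  open LatticeWords using (Word; trues; falses)

  positions : (Bool → Bool) → ℕ → Word → List ℕ
  positions p c []      = []
  positions p c (x ∷ w) = if p x then c ∷ positions p (suc c) w else positions p (suc c) w

  leftPositions rightPositions : ℕ → Word → List ℕ
  leftPositions  = positions id
  rightPositions = positions not

  length-leftPositions : ∀ c w → length (leftPositions c w) ≡ trues w
  length-leftPositions c []          = refl
  length-leftPositions c (true ∷ w)  = cong suc (length-leftPositions (suc c) w)
  length-leftPositions c (false ∷ w) = length-leftPositions (suc c) w

  length-rightPositions : ∀ c w → length (rightPositions c w) ≡ falses w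
  length-rightPositions c []          = refl
  length-rightPositions c (true ∷ w)  = length-rightPositions (suc c) w
  length-rightPositions c (false ∷ w) = cong suc (length-rightPositions (suc c) w)

  data AscendingFrom (lo : ℕ) : List ℕ → Set where
    []  : AscendingFrom lo []
    _∷_ : ∀ {x xs} → lo ≤ x → AscendingFrom (suc x) xs → AscendingFrom lo (x ∷ xs)

  ascending-weaken : ∀ {lo lo′ xs} → lo′ ≤ lo → AscendingFrom lo xs → AscendingFrom lo′ xs
  ascending-weaken p []      = []
  ascending-weaken p (q ∷ s) = ≤-trans p q ∷ s

  ascending-∈ : ∀ {lo xs x} → AscendingFrom lo xs → x ∈ xs → lo ≤ x
  ascending-∈ (q ∷ s) (here refl) = q
  ascending-∈ (q ∷ s) (there m)   = ≤-trans (n≤1+n _) (≤-trans (s≤s q) (ascending-∈ s m))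

  positions-ascending : ∀ p c w → AscendingFrom c (positions p c w)
  positions-ascending p c []      = []
  positions-ascending p c (x ∷ w) with p x
  ... | true  = ≤-refl ∷ positions-ascending p (suc c) w
  ... | false = ascending-weaken (n≤1+n c) (positions-ascending p (suc c) w)

  positions-bound : ∀ p c w {x} → x ∈ positions p c w → x < c + length w
  positions-bound p c (y ∷ w) {x} m = ≤-trans (bound (p y) m) (≤-reflexive (sym (+-suc c (length w))))
    where
    bound : ∀ b → x ∈ (if b then c ∷ positions p (suc c) w else positions p (suc c) w) →
      x < suc (c + length w)
    bound true  (here refl) = s≤s (m≤m+n c (length w))
    bound true  (there m′)  = positions-bound p (suc c) w m′
    bound false m′          = positions-bound p (suc c) w m′

  positions-disjoint : ∀ c w {x} → x ∈ leftPositions c w → x ∈ rightPositions c w → ⊥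
  positions-disjoint c (true ∷ w) (here refl) m =
    <-irrefl refl (ascending-∈ (positions-ascending not (suc c) w) m)
  positions-disjoint c (true ∷ w) (there m₁) m₂ = positions-disjoint (suc c) w m₁ m₂
  positions-disjoint c (false ∷ w) m (here refl) =
    <-irrefl refl (ascending-∈ (positions-ascending id (suc c) w) m)
  positions-disjoint c (false ∷ w) m₁ (there m₂) = positions-disjoint (suc c) w m₁ m₂

  positions-cover : ∀ c w x → c ≤ x → x < c + length w → x ∈ leftPositions c w ⊎ x ∈ rightPositions c w
  positions-cover c [] x p q = ⊥-elim (<-irrefl refl (≤-trans q (≤-trans (≤-reflexive (+-identityʳ c)) p)))
  positions-cover c (b ∷ w) x p q with m≤n⇒m<n∨m≡n p
  positions-cover c (true  ∷ w) x p q | inj₂ refl = inj₁ (here refl)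
  positions-cover c (false ∷ w) x p q | inj₂ refl = inj₂ (here refl)
  positions-cover c (b ∷ w) x p q | inj₁ c<x
    with positions-cover (suc c) w x c<x (≤-trans q (≤-reflexive (+-suc c (length w))))
  positions-cover c (true  ∷ w) x p q | inj₁ _ | inj₁ m = inj₁ (there m)
  positions-cover c (true  ∷ w) x p q | inj₁ _ | inj₂ m = inj₂ m
  positions-cover c (false ∷ w) x p q | inj₁ _ | inj₁ m = inj₁ m
  positions-cover c (false ∷ w) x p q | inj₁ _ | inj₂ m = inj₂ (there m)

  isElem : ℕ → List ℕ → Bool
  isElem y = any (y ≡ᵇ_)

  isElem-sound : ∀ y xs → isElem y xs ≡ true → y ∈ xs
  isElem-sound y xs e with any-elim (y ≡ᵇ_) xs e
  ... | x , m , e′ = subst (_∈ xs) (sym (≡ᵇ-sound y x e′)) m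

  isElem-complete : ∀ y xs → y ∈ xs → isElem y xs ≡ true
  isElem-complete y xs m = any-intro (y ≡ᵇ_) xs m (≡ᵇ-refl y)

  isElem-below : ∀ {lo xs} y → AscendingFrom lo xs → y < lo → isElem y xs ≡ false
  isElem-below y []            p = refl
  isElem-below y (_∷_ {x} q s) p rewrite ≡ᵇ-false y x (λ e → <-irrefl e (≤-trans p q)) =
    isElem-below y s (≤-trans p (≤-trans q (n≤1+n x)))

  interval : ℕ → ℕ → List ℕ
  interval c zero      = []
  interval c (suc len) = c ∷ interval (suc c) len

  map-interval-cong : ∀ {A : Set} (f g : ℕ → A) c len → (∀ y → c ≤ y → f y ≡ g y) →
    map f (interval c len) ≡ map g (interval c len)
  map-interval-cong f g c zero      h = refl
  map-interval-cong f g c (suc len) h =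
    cong₂ _∷_ (h c ≤-refl) (map-interval-cong f g (suc c) len (λ y p → h y (≤-trans (n≤1+n c) p)))

  word-from-positions : ∀ c w → map (λ y → isElem y (leftPositions c w)) (interval c (length w)) ≡ w
  word-from-positions c [] = refl
  word-from-positions c (true ∷ w) rewrite ≡ᵇ-refl c = cong (true ∷_)
    (trans (map-interval-cong _ _ (suc c) (length w)
             (λ y p → cong (_∨ isElem y (leftPositions (suc c) w)) (≡ᵇ-false y c (λ e → <-irrefl (sym e) p))))
           (word-from-positions (suc c) w))
  word-from-positions c (false ∷ w) =
    cong₂ _∷_ (isElem-below c (positions-ascending id (suc c) w) ≤-refl) (word-from-positions (suc c) w)

  positions-map : ∀ p (q : ℕ → Bool) c len →
    positions p c (map q (interval c len)) ≡ filterᵇ (λ y → p (q y)) (interval c len)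
  positions-map p q c zero      = refl
  positions-map p q c (suc len) with p (q c)
  ... | true  = cong (c ∷_) (positions-map p q (suc c) len)
  ... | false = positions-map p q (suc c) len

  private
    lo<lo+1+len : ∀ lo len → lo < lo + suc len
    lo<lo+1+len lo len = ≤-trans (s≤s (m≤m+n lo len)) (≤-reflexive (sym (+-suc lo len)))

    bound-shift : ∀ {lo len} {P : ℕ → Set} → (∀ y → lo ≤ y → y < lo + suc len → P y) →
      ∀ y → suc lo ≤ y → y < suc lo + len → P y
    bound-shift {lo} {len} h y r t = h y (≤-trans (n≤1+n lo) r) (≤-trans t (≤-reflexive (sym (+-suc lo len))))

    all-shift : ∀ {lo len ys} → All (_< lo + suc len) ys → All (_< suc lo + len) ys
    all-shift {lo} {len} = All.map (λ q → ≤-trans q (≤-reflexive (+-suc lo len)))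

  filter-interval : ∀ len lo xs (p : ℕ → Bool) → AscendingFrom lo xs → All (_< lo + len) xs →
    (∀ y → lo ≤ y → y < lo + len → p y ≡ isElem y xs) → filterᵇ p (interval lo len) ≡ xs
  filter-interval zero lo [] p s a h = refl
  filter-interval zero lo (x ∷ xs) p (q ∷ s) (b ∷ a) h =
    ⊥-elim (<-irrefl refl (≤-trans b (≤-trans (≤-reflexive (+-identityʳ lo)) q)))
  filter-interval (suc len) lo [] p s a h =
    trans (filterᵇ-reject p (h lo ≤-refl (lo<lo+1+len lo len)))
          (filter-interval len (suc lo) [] p [] [] (bound-shift h))
  filter-interval (suc len) lo (x ∷ xs) p (q ∷ s) (b ∷ a) h with m≤n⇒m<n∨m≡n q
  ... | inj₂ refl =
    trans (filterᵇ-accept p (trans (h lo ≤-refl b) (cong (_∨ isElem lo xs) (≡ᵇ-refl lo))))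
          (cong (lo ∷_) (filter-interval len (suc lo) xs p s (all-shift a) (λ y r t → bound-shift h′ y r t r)))
    where
    h′ : ∀ y → lo ≤ y → y < lo + suc len → lo < y → p y ≡ isElem y xs
    h′ y r t lo<y = trans (h y r t) (cong (_∨ isElem y xs) (≡ᵇ-false y lo (λ e → <-irrefl (sym e) lo<y)))
  ... | inj₁ lo<x =
    trans (filterᵇ-reject p (trans (h lo ≤-refl (<-trans lo<x b)) (isElem-below lo (lo<x ∷ s) ≤-refl)))
          (filter-interval len (suc lo) (x ∷ xs) p (lo<x ∷ s) (all-shift (b ∷ a)) (bound-shift h))

  -- The a-th entry of a list of numbers (0 past its end).
  nth : List ℕ → ℕ → ℕ
  nth []       _       = 0
  nth (x ∷ xs) zero    = x
  nth (x ∷ xs) (suc a) = nth xs a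

  nth-∈ : ∀ xs a → a < length xs → nth xs a ∈ xs
  nth-∈ (x ∷ xs) zero    p       = here refl
  nth-∈ (x ∷ xs) (suc a) (s≤s p) = there (nth-∈ xs a p)

  ∈⇒nth : ∀ xs {x} → x ∈ xs → Σ ℕ (λ a → a < length xs × nth xs a ≡ x)
  ∈⇒nth (x ∷ xs) (here refl) = 0 , s≤s z≤n , refl
  ∈⇒nth (x ∷ xs) (there m)   = let (a , p , e) = ∈⇒nth xs m in suc a , s≤s p , e

  nth-ascending : ∀ {lo} xs a b → AscendingFrom lo xs → a < b → b < length xs → nth xs a < nth xs b
  nth-ascending (x ∷ xs) zero    (suc b) (q ∷ s) p       (s≤s r) = ascending-∈ s (nth-∈ xs b r)
  nth-ascending (x ∷ xs) (suc a) (suc b) (q ∷ s) (s≤s p) (s≤s r) = nth-ascending xs a b s p r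

-- Row i holds
-- the i-th left position and the i-th right position of w; it violates
-- "left < right" exactly when the i-th down step of w is a flaw.
module RowFlags where

  open import Data.Bool using (Bool; true; false; not)
  open import Data.Nat using (ℕ; zero; suc; _+_; _<_; _≤ᵇ_; _<ᵇ_; z<s)
  open import Data.Nat.Properties
  open import Data.List using (List; []; _∷_; _++_; length; zipWith; replicate; [_])
  open import Data.List.Properties using (++-assoc; length-++)
  open import Relation.Binary.PropositionalEquality hiding ([_])
  open import Data.List.Relation.Unary.All using (All; []; _∷_)
  import Data.List.Relation.Unary.All as All
  import Data.List.Relation.Unary.All.Properties as AllP
  open BooleanTests using (<ᵇ-complete; <ᵇ-false; ≤ᵇ-true; ≤ᵇ-false)
  open LatticeWords using (Word; trues; falses)
  open ChungFeller using (flaws)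
  open Positions using (leftPositions; rightPositions)

  rowFlag : ℕ → ℕ → Bool
  rowFlag a b = not (a <ᵇ b)

  flagVector : ℕ → ℕ → Word → List Bool
  flagVector t s []          = []
  flagVector t s (true ∷ w)  = flagVector (suc t) s w
  flagVector t s (false ∷ w) = (t ≤ᵇ s) ∷ flagVector t (suc s) w

  trues-flagVector : ∀ t s w → trues (flagVector t s w) ≡ flaws t s w
  trues-flagVector t s []          = refl
  trues-flagVector t s (true ∷ w)  = trues-flagVector (suc t) s w
  trues-flagVector t s (false ∷ w) with t ≤ᵇ s
  ... | true  = cong suc (trues-flagVector t (suc s) w)
  ... | false = trues-flagVector t (suc s) w

  length-flagVector : ∀ t s w → length (flagVector t s w) ≡ falses w
  length-flagVector t s []          = refl
  length-flagVector t s (true ∷ w)  = length-flagVector (suc t) s w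
  length-flagVector t s (false ∷ w) = cong suc (length-flagVector t (suc s) w)

  private
    replicate-snoc : ∀ n (xs : List Bool) → replicate (n + 1) true ++ xs ≡ replicate n true ++ true ∷ xs
    replicate-snoc zero    xs = refl
    replicate-snoc (suc n) xs = cong (true ∷_) (replicate-snoc n xs)

    below-suc : ∀ {c} {xs : List ℕ} → All (_< c) xs → All (_< suc c) xs
    below-suc = All.map m<n⇒m<1+n

    below-snoc : ∀ {c} {xs : List ℕ} → All (_< c) xs → All (_< suc c) (xs ++ [ c ])
    below-snoc a = AllP.++⁺ (below-suc a) (≤-refl ∷ [])

    +-length-snoc : ∀ a (xs : List ℕ) x → a + length (xs ++ [ x ]) ≡ suc (a + length xs)
    +-length-snoc a xs x = trans (cong (a +_) (trans (length-++ xs) (+-comm (length xs) 1))) (+-suc a (length xs))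

    suc≡+1 : ∀ {s t} → t ≡ s + 0 → suc s ≡ t + 1
    suc≡+1 {s} {t} e = trans (cong suc (sym (trans e (+-identityʳ s)))) (sym (+-comm t 1))

  -- Reading w from position c in state (t, s), while the left positions ls
  -- wait for their right partners (so t = s + |ls|), all of them before c.
  rowFlags-waitingLeft : ∀ w c t s (ls : List ℕ) → t ≡ s + length ls → All (_< c) ls →
    trues w + length ls ≡ falses w →
    zipWith rowFlag (ls ++ leftPositions c w) (rightPositions c w) ≡ flagVector t s w

  -- Dually, the right positions rs wait (s = t + |rs|); their rows are flawed.
  rowFlags-waitingRight : ∀ w c t s (rs : List ℕ) → s ≡ t + length rs → All (_< c) rs →
    trues w ≡ falses w + length rs →
    zipWith rowFlag (leftPositions c w) (rs ++ rightPositions c w) ≡ replicate (length rs) true ++ flagVector t s w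

  rowFlags-waitingLeft [] c t s [] _ _ _ = refl
  rowFlags-waitingLeft [] c t s (l ∷ ls) _ _ ()
  -- an up step joins the waiting left positions
  rowFlags-waitingLeft (true ∷ w) c t s ls e ls<c bal =
    trans (cong (λ z → zipWith rowFlag z (rightPositions (suc c) w)) (sym (++-assoc ls [ c ] (leftPositions (suc c) w))))
      (rowFlags-waitingLeft w (suc c) (suc t) s (ls ++ [ c ]) (trans (cong suc e) (sym (+-length-snoc s ls c)))
        (below-snoc ls<c) (trans (+-length-snoc (trues w) ls c) bal))
  -- a down step completes the oldest waiting row, which is sound: the step
  -- starts above level 0
  rowFlags-waitingLeft (false ∷ w) c t s (l ∷ ls) e (l<c ∷ ls<c) bal =
    cong₂ _∷_ (trans (cong not (<ᵇ-complete l<c)) (sym (≤ᵇ-false (subst (s <_) (sym e) (m<m+n s z<s)))))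
      (rowFlags-waitingLeft w (suc c) t (suc s) ls (trans e (+-suc s (length ls))) (below-suc ls<c)
        (suc-injective (trans (sym (+-suc (trues w) (length ls))) bal)))
  -- a down step at level 0 is a flaw and starts waiting on the right
  rowFlags-waitingLeft (false ∷ w) c t s [] e _ bal =
    trans (rowFlags-waitingRight w (suc c) t (suc s) [ c ] (suc≡+1 e) (≤-refl ∷ [])
            (trans (sym (+-identityʳ (trues w))) (trans bal (sym (+-comm (falses w) 1)))))
          (cong (_∷ flagVector t (suc s) w) (sym (≤ᵇ-true (≤-reflexive (trans e (+-identityʳ s))))))

  rowFlags-waitingRight [] c t s [] _ _ _ = refl
  rowFlags-waitingRight [] c t s (r ∷ rs) _ _ ()
  -- an up step completes the oldest waiting row, which is flawed
  rowFlags-waitingRight (true ∷ w) c t s (r ∷ rs) e (r<c ∷ rs<c) bal =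
    cong₂ _∷_ (cong not (<ᵇ-false c r (<⇒≤ r<c)))
      (rowFlags-waitingRight w (suc c) (suc t) s rs (trans e (+-suc t (length rs))) (below-suc rs<c)
        (suc-injective (trans bal (+-suc (falses w) (length rs)))))
  -- an up step at level 0 starts waiting on the left
  rowFlags-waitingRight (true ∷ w) c t s [] e _ bal =
    rowFlags-waitingLeft w (suc c) (suc t) s [ c ] (suc≡+1 e) (≤-refl ∷ [])
      (trans (+-comm (trues w) 1) (trans bal (+-identityʳ (falses w))))
  -- a down step below level 0 is a flaw and joins the waiting right positions
  rowFlags-waitingRight (false ∷ w) c t s rs e rs<c bal =
    trans (cong (zipWith rowFlag (leftPositions (suc c) w)) (sym (++-assoc rs [ c ] (rightPositions (suc c) w))))
      (trans (rowFlags-waitingRight w (suc c) t (suc s) (rs ++ [ c ]) (trans (cong suc e) (sym (+-length-snoc t rs c)))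
               (below-snoc rs<c) (trans bal (sym (+-length-snoc (falses w) rs c))))
        (trans (cong (λ z → replicate z true ++ flagVector t (suc s) w) (length-++ rs))
          (trans (replicate-snoc (length rs) (flagVector t (suc s) w))
            (cong (λ z → replicate (length rs) true ++ z ∷ flagVector t (suc s) w)
                  (sym (≤ᵇ-true (subst (t ≤_) (sym e) (m≤m+n t (length rs)))))))))

  rowFlags : ∀ w → trues w ≡ falses w →
    zipWith rowFlag (leftPositions 0 w) (rightPositions 0 w) ≡ flagVector 0 0 w
  rowFlags w bal = rowFlags-waitingLeft w 0 0 0 [] refl [] (trans (+-identityʳ (trues w)) bal)

module Fillings where

  open import Data.Bool using (Bool; true; false; not; _∧_; _∨_)
  open import Function using (id)
  open import Data.Bool.Properties using (∧-zeroʳ; not-involutive)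
  open import Data.Bool.ListAction using (all; any)
  open import Data.Nat using (ℕ; zero; suc; _+_; _*_; _≤_; _<_; z≤n; s≤s; _≡ᵇ_; _<ᵇ_)
  open import Data.Nat.Properties
  open import Data.Fin using (Fin; toℕ; zero; suc; fromℕ<)
  open import Data.Fin.Properties using (toℕ-injective; toℕ<n; toℕ-fromℕ<)
  open import Data.Fin.Subset using (Subset)
  open import Data.List using (List; []; _∷_; tabulate; zipWith)
  import Data.List as List
  open import Data.Vec using (Vec; []; _∷_; lookup)
  import Data.Vec as Vec
  open import Data.Vec.Properties using (lookup∘tabulate; tabulate∘lookup)
  import Data.Vec.Properties as VecP
  open import Data.List.Properties using (tabulate-cong; length-tabulate)
  import Data.List.Relation.Unary.All.Properties as AllP
  open import Data.Product using (_×_; _,_; proj₁; proj₂; Σ)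
  open import Data.Sum using (_⊎_; inj₁; inj₂)
  open import Data.Empty using (⊥; ⊥-elim)
  open import Relation.Binary using (tri<; tri≈; tri>)
  open import Relation.Binary.PropositionalEquality
  open import Data.List.Membership.Propositional using (_∈_)
  open import Data.List.Membership.Propositional.Properties
    using (∈-allFin; ∈-cartesianProduct⁺; ∈-tabulate⁺; ∈-tabulate⁻; ∈-map⁺; ∈-map⁻; ∈-++⁺ˡ; ∈-++⁺ʳ; ∈-++⁻)
  open import Data.List.Relation.Unary.Any using (here; there)
  open import Data.List.Relation.Unary.Unique.Propositional using (Unique; []; _∷_)
  import Data.List.Relation.Unary.Unique.Propositional.Properties as Unique
  import Data.List.Relation.Unary.All as All
  open BooleanTests
  open ListCounting using (all-elim; all-intro; any-elim; any-intro)
  open WallSets using (containsFlagged)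
  open RowFlags using (rowFlag; flagVector; rowFlags)
  open LatticeWords using (Word; trues; falses; words; ∈-words⁺; ∈-words⁻; length-balanced)
  open Positions

  leftLabel rightLabel : ∀ {n} → Filling n → Fin n → ℕ
  leftLabel  v i = toℕ (proj₁ (lookup v i))
  rightLabel v i = toℕ (proj₂ (lookup v i))

  record ColumnFilling {n} (v : Filling n) : Set where
    field
      leftIncreasing  : ∀ i j → toℕ i < toℕ j → leftLabel v i < leftLabel v j
      rightIncreasing : ∀ i j → toℕ i < toℕ j → rightLabel v i < rightLabel v j
      disjoint        : ∀ i j → leftLabel v i ≢ rightLabel v j
      covers          : ∀ (l : Fin (2 * n)) →
        (Σ (Fin n) λ i → leftLabel v i ≡ toℕ l) ⊎ (Σ (Fin n) λ i → rightLabel v i ≡ toℕ l)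

  cell∈allCells : ∀ {n} (c : Cell n) → c ∈ allCells n
  cell∈allCells (i , a) = ∈-cartesianProduct⁺ (∈-allFin i) (∈-allFin a)

  increasing⇒injective : ∀ {n} (f : Fin n → ℕ) → (∀ i j → toℕ i < toℕ j → f i < f j) →
    ∀ i j → f i ≡ f j → i ≡ j
  increasing⇒injective f inc i j e with <-cmp (toℕ i) (toℕ j)
  ... | tri< i<j _ _ = ⊥-elim (<-irrefl e (inc i j i<j))
  ... | tri≈ _ i≡j _ = toℕ-injective i≡j
  ... | tri> _ _ j<i = ⊥-elim (<-irrefl (sym e) (inc j i j<i))

  labelsInjective labelsSurjective : ∀ {n} → Filling n → Bool
  labelsInjective  {n} v =
    all (λ c → all (λ c′ → not (label v c =ᶠ label v c′) ∨ (c =ᶜ c′)) (allCells n)) (allCells n)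
  labelsSurjective {n} v = all (λ l → any (λ c → label v c =ᶠ l) (allCells n)) (List.allFin (2 * n))

  isValid⇒columnFilling : ∀ {n} (W : Subset n) (v : Filling n) → isValid W v ≡ true →
    ColumnFilling v × rowsOK W v ≡ true
  isValid⇒columnFilling {n} W v valid = record
    { leftIncreasing  = λ i j p → proj₁ (increasing i j p)
    ; rightIncreasing = λ i j p → proj₂ (increasing i j p)
    ; disjoint = disjoint
    ; covers = covers
    } , rows
    where
    bijective  = proj₁ (∧-elim valid)
    columns    = proj₁ (∧-elim (proj₂ (∧-elim {isBijective v} valid)))
    rows       = proj₂ (∧-elim {columnsIncrease v} (proj₂ (∧-elim {isBijective v} valid)))
    injective  = proj₁ (∧-elim bijective)
    surjective = proj₂ (∧-elim {labelsInjective v} bijective)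
    increasing : ∀ i j → toℕ i < toℕ j → leftLabel v i < leftLabel v j × rightLabel v i < rightLabel v j
    increasing i j i<j with all-elim _ _ (all-elim _ _ columns (∈-allFin i)) (∈-allFin j)
    ... | q rewrite <ᵇ-complete i<j = let (l , r) = ∧-elim q in <ᵇ-sound _ _ l , <ᵇ-sound _ _ r
    disjoint : ∀ i j → leftLabel v i ≢ rightLabel v j
    disjoint i j eq with all-elim _ _ (all-elim _ _ injective (cell∈allCells (i , zero))) (cell∈allCells (j , suc zero))
    ... | q rewrite eq | ≡ᵇ-refl (rightLabel v j) | ∧-zeroʳ (toℕ i ≡ᵇ toℕ j) with q
    ... | ()
    covers : ∀ (l : Fin (2 * n)) →
      (Σ (Fin n) λ i → leftLabel v i ≡ toℕ l) ⊎ (Σ (Fin n) λ i → rightLabel v i ≡ toℕ l)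
    covers l with any-elim (λ c → label v c =ᶠ l) (allCells n) (all-elim _ _ surjective (∈-allFin l))
    ... | (i , zero)     , _ , q = inj₁ (i , ≡ᵇ-sound _ _ q)
    ... | (i , suc zero) , _ , q = inj₂ (i , ≡ᵇ-sound _ _ q)

  columnFilling⇒isBijective : ∀ {n} (v : Filling n) → ColumnFilling v → isBijective v ≡ true
  columnFilling⇒isBijective {n} v cf = ∧-intro injective surjective
    where
    open ColumnFilling cf
    same-cell : ∀ (c c′ : Cell n) → toℕ (label v c) ≡ toℕ (label v c′) → (c =ᶜ c′) ≡ true
    same-cell (i , zero) (j , zero) e
      rewrite increasing⇒injective (leftLabel v) leftIncreasing i j e | ≡ᵇ-refl (toℕ j) = refl
    same-cell (i , suc zero) (j , suc zero) e
      rewrite increasing⇒injective (rightLabel v) rightIncreasing i j e | ≡ᵇ-refl (toℕ j) = refl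
    same-cell (i , zero) (j , suc zero) e = ⊥-elim (disjoint i j e)
    same-cell (i , suc zero) (j , zero) e = ⊥-elim (disjoint j i (sym e))
    no-collision : ∀ (c c′ : Cell n) → (not (label v c =ᶠ label v c′) ∨ (c =ᶜ c′)) ≡ true
    no-collision c c′ with label v c =ᶠ label v c′ in eq
    ... | false = refl
    ... | true  = same-cell c c′ (≡ᵇ-sound _ _ eq)
    injective : labelsInjective v ≡ true
    injective = all-intro _ (allCells n) (λ {c} _ → all-intro _ (allCells n) (λ {c′} _ → no-collision c c′))
    hit : ∀ l → any (λ c → label v c =ᶠ l) (allCells n) ≡ true
    hit l with covers l
    ... | inj₁ (i , e) = any-intro _ (allCells n) (cell∈allCells (i , zero)) (≡ᵇ-complete e)
    ... | inj₂ (i , e) = any-intro _ (allCells n) (cell∈allCells (i , suc zero)) (≡ᵇ-complete e)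
    surjective : labelsSurjective v ≡ true
    surjective = all-intro _ (List.allFin (2 * n)) (λ {l} _ → hit l)

  columnFilling⇒columnsIncrease : ∀ {n} (v : Filling n) → ColumnFilling v → columnsIncrease v ≡ true
  columnFilling⇒columnsIncrease {n} v cf =
    all-intro _ (List.allFin n) (λ {i} _ → all-intro _ (List.allFin n) (λ {j} _ → ordered i j))
    where
    open ColumnFilling cf
    ordered : ∀ i j → (not (toℕ i <ᵇ toℕ j) ∨
      ((proj₁ (lookup v i) <ᶠ proj₁ (lookup v j)) ∧ (proj₂ (lookup v i) <ᶠ proj₂ (lookup v j)))) ≡ true
    ordered i j with toℕ i <ᵇ toℕ j in eq
    ... | false = refl
    ... | true rewrite <ᵇ-complete (leftIncreasing i j (<ᵇ-sound _ _ eq))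
                     | <ᵇ-complete (rightIncreasing i j (<ᵇ-sound _ _ eq)) = refl

  andFin : ∀ n → (Fin n → Bool) → Bool
  andFin zero    q = true
  andFin (suc n) q = q zero ∧ andFin n (λ i → q (suc i))

  all-tabulate : ∀ n {A : Set} (q : A → Bool) (f : Fin n → A) → all q (tabulate f) ≡ andFin n (λ i → q (f i))
  all-tabulate zero    q f = refl
  all-tabulate (suc n) q f = cong (q (f zero) ∧_) (all-tabulate n q (λ i → f (suc i)))

  rowsOK≡containsFlagged : ∀ {n} (W : Subset n) (v : Filling n) →
    rowsOK W v ≡ containsFlagged W (zipWith rowFlag (tabulate (leftLabel v)) (tabulate (rightLabel v)))
  rowsOK≡containsFlagged {n} W v =
    trans (all-tabulate n (λ i → lookup W i ∨ (proj₁ (lookup v i) <ᶠ proj₂ (lookup v i))) (λ i → i)) (rows W v)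
    where
    rows : ∀ {n K} (W : Vec Bool n) (v : Vec (Fin K × Fin K) n) →
      andFin n (λ i → lookup W i ∨ (proj₁ (lookup v i) <ᶠ proj₂ (lookup v i))) ≡
      containsFlagged W (zipWith rowFlag (tabulate (λ i → toℕ (proj₁ (lookup v i))))
                                         (tabulate (λ i → toℕ (proj₂ (lookup v i)))))
    rows []      []             = refl
    rows (x ∷ W) ((a , b) ∷ v) = cong₂ _∧_ (cong (x ∨_) (sym (not-involutive (toℕ a <ᵇ toℕ b)))) (rows W v)

  -- From here on the grid has n = suc m rows, so the labels 0 … 2n−1 form
  -- Fin (suc (top m)) with top m = 2n−1.
  top : ℕ → ℕ
  top m = m + suc (m + 0)

  -- ℕ → Fin (suc K), saturating at K; it is exact below K.
  clamp : (K : ℕ) → ℕ → Fin (suc K)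
  clamp K       zero    = zero
  clamp zero    (suc x) = zero
  clamp (suc K) (suc x) = suc (clamp K x)

  toℕ-clamp : ∀ K x → x ≤ K → toℕ (clamp K x) ≡ x
  toℕ-clamp K       zero    p       = refl
  toℕ-clamp (suc K) (suc x) (s≤s p) = cong suc (toℕ-clamp K x p)

  clamp-toℕ : ∀ K (i : Fin (suc K)) → clamp K (toℕ i) ≡ i
  clamp-toℕ K       zero    = refl
  clamp-toℕ (suc K) (suc i) = cong suc (clamp-toℕ K i)

  tabulate-nth : ∀ n xs → List.length xs ≡ n → tabulate {n = n} (λ i → nth xs (toℕ i)) ≡ xs
  tabulate-nth zero    []       e = refl
  tabulate-nth (suc n) (x ∷ xs) e = cong (x ∷_) (tabulate-nth n xs (suc-injective e))

  nth-tabulate : ∀ {n} (f : Fin n → ℕ) (i : Fin n) → nth (tabulate f) (toℕ i) ≡ f i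
  nth-tabulate f zero    = refl
  nth-tabulate f (suc i) = nth-tabulate (λ j → f (suc j)) i

  tabulate-ascending : ∀ {n} (f : Fin n → ℕ) lo → (∀ i j → toℕ i < toℕ j → f i < f j) → (∀ i → lo ≤ f i) →
    AscendingFrom lo (tabulate f)
  tabulate-ascending {zero}  f lo inc bound = []
  tabulate-ascending {suc n} f lo inc bound = bound zero ∷
    tabulate-ascending (λ j → f (suc j)) (suc (f zero))
      (λ i j p → inc (suc i) (suc j) (s≤s p)) (λ i → inc zero (suc i) (s≤s z≤n))

  fillingRow : ∀ m → Word → Fin (suc m) → Fin (2 * suc m) × Fin (2 * suc m)
  fillingRow m w i = clamp (top m) (nth (leftPositions 0 w) (toℕ i)) , clamp (top m) (nth (rightPositions 0 w) (toℕ i))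

  fillingOf : ∀ m → Word → Filling (suc m)
  fillingOf m w = Vec.tabulate (fillingRow m w)

  wordOf : ∀ m → Filling (suc m) → Word
  wordOf m v = List.map (λ y → isElem y (tabulate (leftLabel v))) (interval 0 (2 * suc m))

  nth-positions-exact : ∀ m p w → List.length w ≡ 2 * suc m → List.length (positions p 0 w) ≡ suc m →
    ∀ (i : Fin (suc m)) → toℕ (clamp (top m) (nth (positions p 0 w) (toℕ i))) ≡ nth (positions p 0 w) (toℕ i)
  nth-positions-exact m p w lw lp i = toℕ-clamp (top m) _ (≤-pred (≤-trans below (≤-reflexive lw)))
    where
    below : nth (positions p 0 w) (toℕ i) < List.length w
    below = positions-bound p 0 w (nth-∈ (positions p 0 w) (toℕ i) (≤-trans (toℕ<n i) (≤-reflexive (sym lp))))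

  module FromWord (m : ℕ) {w : Word} (balanced : w ∈ words (suc m) (suc m)) where

    ls rs : List ℕ
    ls = leftPositions 0 w
    rs = rightPositions 0 w

    length-w : List.length w ≡ 2 * suc m
    length-w = length-balanced {suc m} balanced

    length-ls : List.length ls ≡ suc m
    length-ls = trans (length-leftPositions 0 w) (proj₁ (∈-words⁻ (suc m) (suc m) balanced))

    length-rs : List.length rs ≡ suc m
    length-rs = trans (length-rightPositions 0 w) (proj₂ (∈-words⁻ (suc m) (suc m) balanced))

    left-label : ∀ i → leftLabel (fillingOf m w) i ≡ nth ls (toℕ i)
    left-label i = trans (cong (λ r → toℕ (proj₁ r)) (lookup∘tabulate (fillingRow m w) i))
                         (nth-positions-exact m id w length-w length-ls i)

    right-label : ∀ i → rightLabel (fillingOf m w) i ≡ nth rs (toℕ i)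
    right-label i = trans (cong (λ r → toℕ (proj₂ r)) (lookup∘tabulate (fillingRow m w) i))
                          (nth-positions-exact m not w length-w length-rs i)

    i<length : ∀ (xs : List ℕ) → List.length xs ≡ suc m → (i : Fin (suc m)) → toℕ i < List.length xs
    i<length xs e i = ≤-trans (toℕ<n i) (≤-reflexive (sym e))

    row-of : ∀ (xs : List ℕ) → List.length xs ≡ suc m → ∀ {x} → x ∈ xs →
      Σ (Fin (suc m)) λ i → nth xs (toℕ i) ≡ x
    row-of xs e x∈ with ∈⇒nth xs x∈
    ... | a , a< , eq = let a<n = ≤-trans a< (≤-reflexive e) in fromℕ< a<n , trans (cong (nth xs) (toℕ-fromℕ< a<n)) eq

    columnFilling : ColumnFilling (fillingOf m w)
    columnFilling = record
      { leftIncreasing  = λ i j p → subst₂ _<_ (sym (left-label i)) (sym (left-label j))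
          (nth-ascending ls (toℕ i) (toℕ j) (positions-ascending id 0 w) p (i<length ls length-ls j))
      ; rightIncreasing = λ i j p → subst₂ _<_ (sym (right-label i)) (sym (right-label j))
          (nth-ascending rs (toℕ i) (toℕ j) (positions-ascending not 0 w) p (i<length rs length-rs j))
      ; disjoint = λ i j e → positions-disjoint 0 w (nth-∈ ls (toℕ i) (i<length ls length-ls i))
          (subst (_∈ rs) (trans (sym (right-label j)) (trans (sym e) (left-label i)))
                 (nth-∈ rs (toℕ j) (i<length rs length-rs j)))
      ; covers = covers
      }
      where
      covers : ∀ (l : Fin (2 * suc m)) → (Σ (Fin (suc m)) λ i → leftLabel (fillingOf m w) i ≡ toℕ l) ⊎
                                          (Σ (Fin (suc m)) λ i → rightLabel (fillingOf m w) i ≡ toℕ l)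
      covers l with positions-cover 0 w (toℕ l) z≤n (≤-trans (toℕ<n l) (≤-reflexive (sym length-w)))
      ... | inj₁ l∈ = let (i , e) = row-of ls length-ls l∈ in inj₁ (i , trans (left-label i) e)
      ... | inj₂ l∈ = let (i , e) = row-of rs length-rs l∈ in inj₂ (i , trans (right-label i) e)

    tabulate-left : tabulate (leftLabel (fillingOf m w)) ≡ ls
    tabulate-left = trans (tabulate-cong left-label) (tabulate-nth (suc m) ls length-ls)

    tabulate-right : tabulate (rightLabel (fillingOf m w)) ≡ rs
    tabulate-right = trans (tabulate-cong right-label) (tabulate-nth (suc m) rs length-rs)

    rowFlags-fillingOf : zipWith rowFlag (tabulate (leftLabel (fillingOf m w))) (tabulate (rightLabel (fillingOf m w)))
                         ≡ flagVector 0 0 w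
    rowFlags-fillingOf = trans (cong₂ (zipWith rowFlag) tabulate-left tabulate-right)
      (rowFlags w (trans (proj₁ (∈-words⁻ (suc m) (suc m) balanced)) (sym (proj₂ (∈-words⁻ (suc m) (suc m) balanced)))))

    isValid-fillingOf : ∀ (W : Subset (suc m)) → containsFlagged W (flagVector 0 0 w) ≡ true →
      isValid W (fillingOf m w) ≡ true
    isValid-fillingOf W admitted
      rewrite columnFilling⇒isBijective (fillingOf m w) columnFilling
            | columnFilling⇒columnsIncrease (fillingOf m w) columnFilling =
      trans (rowsOK≡containsFlagged W (fillingOf m w)) (trans (cong (containsFlagged W) rowFlags-fillingOf) admitted)

    wordOf-fillingOf : wordOf m (fillingOf m w) ≡ w
    wordOf-fillingOf =
      trans (cong₂ (λ xs len → List.map (λ y → isElem y xs) (interval 0 len)) tabulate-left (sym length-w))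
            (word-from-positions 0 w)

  isElem-tabulate⁻ : ∀ {n} (f : Fin n → ℕ) y → isElem y (tabulate f) ≡ true → Σ (Fin n) λ i → f i ≡ y
  isElem-tabulate⁻ f y e with ∈-tabulate⁻ (isElem-sound y (tabulate f) e)
  ... | i , y≡ = i , sym y≡

  isElem-tabulate⁺ : ∀ {n} (f : Fin n → ℕ) i → isElem (f i) (tabulate f) ≡ true
  isElem-tabulate⁺ f i = isElem-complete (f i) (tabulate f) (∈-tabulate⁺ {f = f} i)

  module FromFilling (m : ℕ) (W : Subset (suc m)) {v : Filling (suc m)} (valid : isValid W v ≡ true) where

    open ColumnFilling (proj₁ (isValid⇒columnFilling W v valid))

    Ls Rs : List ℕ
    Ls = tabulate (leftLabel v)
    Rs = tabulate (rightLabel v)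

    w : Word
    w = wordOf m v

    right≡not-left : ∀ y → y < 2 * suc m → not (isElem y Ls) ≡ isElem y Rs
    right≡not-left y y< with covers (fromℕ< y<)
    ... | inj₁ (i , ei) rewrite toℕ-fromℕ< y< with isElem y Rs in eq
    ...   | true  = ⊥-elim (let (j , ej) = isElem-tabulate⁻ (rightLabel v) y eq in disjoint i j (trans ei (sym ej)))
    ...   | false rewrite sym ei | isElem-tabulate⁺ (leftLabel v) i = refl
    right≡not-left y y< | inj₂ (i , ei) rewrite toℕ-fromℕ< y< with isElem y Ls in eq
    ...   | true  = ⊥-elim (let (j , ej) = isElem-tabulate⁻ (leftLabel v) y eq in disjoint j i (trans ej (sym ei)))
    ...   | false rewrite sym ei | isElem-tabulate⁺ (rightLabel v) i = refl

    leftPositions-wordOf : leftPositions 0 w ≡ Ls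
    leftPositions-wordOf = trans (positions-map id (λ y → isElem y Ls) 0 (2 * suc m))
      (filter-interval (2 * suc m) 0 Ls (λ y → isElem y Ls)
        (tabulate-ascending (leftLabel v) 0 leftIncreasing (λ _ → z≤n))
        (AllP.tabulate⁺ (λ i → toℕ<n (proj₁ (lookup v i)))) (λ y _ _ → refl))

    rightPositions-wordOf : rightPositions 0 w ≡ Rs
    rightPositions-wordOf = trans (positions-map not (λ y → isElem y Ls) 0 (2 * suc m))
      (filter-interval (2 * suc m) 0 Rs (λ y → not (isElem y Ls))
        (tabulate-ascending (rightLabel v) 0 rightIncreasing (λ _ → z≤n))
        (AllP.tabulate⁺ (λ i → toℕ<n (proj₂ (lookup v i)))) (λ y _ y< → right≡not-left y y<))

    trues-wordOf : trues w ≡ suc m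
    trues-wordOf = trans (sym (length-leftPositions 0 w))
      (trans (cong List.length leftPositions-wordOf) (length-tabulate (leftLabel v)))

    falses-wordOf : falses w ≡ suc m
    falses-wordOf = trans (sym (length-rightPositions 0 w))
      (trans (cong List.length rightPositions-wordOf) (length-tabulate (rightLabel v)))

    wordOf-balanced : w ∈ words (suc m) (suc m)
    wordOf-balanced = ∈-words⁺ trues-wordOf falses-wordOf

    walls-cover-flaws : containsFlagged W (flagVector 0 0 w) ≡ true
    walls-cover-flaws = begin
      containsFlagged W (flagVector 0 0 w)
        ≡⟨ cong (containsFlagged W) (rowFlags w (trans trues-wordOf (sym falses-wordOf))) ⟨
      containsFlagged W (zipWith rowFlag (leftPositions 0 w) (rightPositions 0 w))
        ≡⟨ cong₂ (λ a b → containsFlagged W (zipWith rowFlag a b)) leftPositions-wordOf rightPositions-wordOf ⟩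
      containsFlagged W (zipWith rowFlag Ls Rs)
        ≡⟨ rowsOK≡containsFlagged W v ⟨
      rowsOK W v
        ≡⟨ proj₂ (isValid⇒columnFilling W v valid) ⟩
      true
        ∎
      where open ≡-Reasoning

    fillingOf-wordOf : fillingOf m w ≡ v
    fillingOf-wordOf = begin
      Vec.tabulate (fillingRow m w)
        ≡⟨ VecP.tabulate-cong same-row ⟩
      Vec.tabulate (lookup v)
        ≡⟨ tabulate∘lookup v ⟩
      v ∎
      where
      open ≡-Reasoning
      same-row : ∀ i → fillingRow m w i ≡ lookup v i
      same-row i rewrite leftPositions-wordOf | rightPositions-wordOf
                       | nth-tabulate (leftLabel v) i | nth-tabulate (rightLabel v) i
                       = cong₂ _,_ (clamp-toℕ (top m) (proj₁ (lookup v i))) (clamp-toℕ (top m) (proj₂ (lookup v i)))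

  ∈-allVecs : ∀ {A : Set} (xs : List A) n (v : Vec A n) → (∀ x → x ∈ xs) → v ∈ allVecs xs n
  ∈-allVecs xs zero    []      every = here refl
  ∈-allVecs xs (suc n) (x ∷ v) every = prefix xs (every x)
    where
    prefix : ∀ ys → x ∈ ys → (x ∷ v) ∈ List.concatMap (λ y → List.map (y ∷_) (allVecs xs n)) ys
    prefix (y ∷ ys) (here refl) = ∈-++⁺ˡ (∈-map⁺ (y ∷_) (∈-allVecs xs n v every))
    prefix (y ∷ ys) (there x∈)  = ∈-++⁺ʳ (List.map (y ∷_) (allVecs xs n)) (prefix ys x∈)

  allVecs-unique : ∀ {A : Set} (xs : List A) n → Unique xs → Unique (allVecs xs n)
  allVecs-unique xs zero    u = All.[] ∷ []
  allVecs-unique xs (suc n) u = blocks xs u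
    where
    head∈ : ∀ {x v} ys → (x ∷ v) ∈ List.concatMap (λ y → List.map (y ∷_) (allVecs xs n)) ys → x ∈ ys
    head∈ (y ∷ ys) m with ∈-++⁻ (List.map (y ∷_) (allVecs xs n)) m
    ... | inj₁ m₁ with ∈-map⁻ (y ∷_) m₁
    ...   | _ , _ , refl = here refl
    head∈ (y ∷ ys) m | inj₂ m₂ = there (head∈ ys m₂)
    blocks : ∀ ys → Unique ys → Unique (List.concatMap (λ y → List.map (y ∷_) (allVecs xs n)) ys)
    blocks []       _          = []
    blocks (y ∷ ys) (y∉ ∷ uys) =
      Unique.++⁺ (Unique.map⁺ VecP.∷-injectiveʳ (allVecs-unique xs n u)) (blocks ys uys) disjoint
      where
      disjoint : ∀ {v} → v ∈ List.map (y ∷_) (allVecs xs n) ×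
                         v ∈ List.concatMap (λ y → List.map (y ∷_) (allVecs xs n)) ys → ⊥
      disjoint (m₁ , m₂) with ∈-map⁻ (y ∷_) m₁
      ... | _ , _ , refl = All.lookup y∉ (head∈ ys m₂) refl

module Assembly where

  open import Data.Bool using (Bool)
  open import Data.Nat using (suc)
  open import Data.Nat.Properties using (≤-pred)
  open import Data.List.Membership.Propositional using (_∈_)
  open import Data.List using (List; map; length; filterᵇ; cartesianProduct)
  import Data.List as List
  open import Data.Nat.ListAction using (sum)
  open import Data.Fin using (Fin)
  open import Data.Fin.Subset using (Subset)
  open import Data.Product using (_×_; _,_; proj₂)
  open import Relation.Binary.PropositionalEquality
  import Data.List.Relation.Unary.Unique.Propositional.Properties as Unique
  open import Data.List.Membership.Propositional.Properties using (∈-allFin; ∈-cartesianProduct⁺)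
  open ListCounting
  open Binomials
  open LatticeWords using (Word; words; words-unique; ∈-words⁻)
  open ChungFeller using (flaws; wordsWithFlaws; flaws-bound; chung-feller)
  open WallSets using (containsFlagged; wallSets-containing)
  open RowFlags using (flagVector; trues-flagVector; length-flagVector)
  open Fillings

  admits : ∀ {n} → Subset n → Word → Bool
  admits W w = containsFlagged W (flagVector 0 0 w)

  N≡admitted : ∀ m (W : Subset (suc m)) → N W ≡ length (filterᵇ (admits W) (words (suc m) (suc m)))
  N≡admitted m W = count-bijection (allVecs cells (suc m)) (words (suc m) (suc m)) (isValid W) (admits W)
    (wordOf m) (fillingOf m)
    (allVecs-unique cells (suc m) (Unique.cartesianProduct⁺ (Unique.allFin⁺ _) (Unique.allFin⁺ _)))
    (words-unique (suc m) (suc m))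
    (λ {v} _ valid → let open FromFilling m W {v} valid in wordOf-balanced , walls-cover-flaws , fillingOf-wordOf)
    (λ {w} balanced admitted → let open FromWord m balanced in
      ∈-allVecs cells (suc m) (fillingOf m w) (λ (a , b) → ∈-cartesianProduct⁺ (∈-allFin a) (∈-allFin b)) ,
      isValid-fillingOf W admitted , wordOf-fillingOf)
    where
    cells : List (Fin (2 * suc m) × Fin (2 * suc m))
    cells = cartesianProduct (List.allFin (2 * suc m)) (List.allFin (2 * suc m))

  sumN≡Σsupersets : ∀ m k → sumN (suc m) k ≡ sum (map (λ w → supersets (suc m) k (flaws 0 0 w)) (words (suc m) (suc m)))
  sumN≡Σsupersets m k = begin
    sum (map N Ws)
      ≡⟨ sum-map-cong N (λ W → length (filterᵇ (admits W) (words n n))) Ws (λ {W} _ → N≡admitted m W) ⟩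
    sum (map (λ W → length (filterᵇ (admits W) (words n n))) Ws)
      ≡⟨ double-counting admits Ws (words n n) ⟩
    sum (map (λ w → length (filterᵇ (λ W → admits W w) Ws)) (words n n))
      ≡⟨ sum-map-cong _ _ (words n n) admitting ⟩
    sum (map (λ w → supersets n k (flaws 0 0 w)) (words n n))
      ∎
    where
    open ≡-Reasoning
    n = suc m
    Ws = subsetsOfSize n k
    admitting : ∀ {w} → w ∈ words n n → length (filterᵇ (λ W → admits W w) Ws) ≡ supersets n k (flaws 0 0 w)
    admitting {w} balanced =
      trans (wallSets-containing n k (flagVector 0 0 w) (trans (length-flagVector 0 0 w) (proj₂ (∈-words⁻ n n balanced))))
            (cong (supersets n k) (trues-flagVector 0 0 w))

  -- By Chung–Feller every flaw count j ≤ n is equally frequent, and the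
  -- hockey stick sums the C(n−j, k−j).
  Σsupersets≡flawless*binom : ∀ m k → k ≤ suc m →
    sum (map (λ w → supersets (suc m) k (flaws 0 0 w)) (words (suc m) (suc m))) ≡
    wordsWithFlaws (suc m) 0 * binom (suc (suc m)) k
  Σsupersets≡flawless*binom m k k≤n = begin
    sum (map (λ w → supersets n k (flaws 0 0 w)) (words n n))
      ≡⟨ sum-by-value (flaws 0 0) (supersets n k) (suc n) (words n n) (flaws-bound n) ⟩
    sumBelow (λ j → wordsWithFlaws n j * supersets n k j) (suc n)
      ≡⟨ sumBelow-cong _ _ (suc n) (λ j j≤n → cong (_* supersets n k j) (chung-feller n j (≤-pred j≤n))) ⟩
    sumBelow (λ j → wordsWithFlaws n 0 * supersets n k j) (suc n)
      ≡⟨ sumBelow-* (wordsWithFlaws n 0) (supersets n k) (suc n) ⟩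
    wordsWithFlaws n 0 * sumBelow (supersets n k) (suc n)
      ≡⟨ cong (wordsWithFlaws n 0 *_) (hockey-stick n k k≤n) ⟩
    wordsWithFlaws n 0 * binom (suc n) k
      ∎
    where
    open ≡-Reasoning
    n = suc m

open Assembly using (sumN≡Σsupersets; Σsupersets≡flawless*binom)
open Binomials using (binom; binom≡C; complement-absorption)
open ChungFeller using (wordsWithFlaws; chung-feller-total)

-- With c = #flawless balanced words (the Catalan number):
-- (n+1−k)·Σ_W N(W) = (n+1−k)·c·C(n+1,k) = c·(n+1)·C(n,k) = C(n,k)·C(2n,n).
mainTheorem2 : (n k : ℕ) → 1 ≤ n → k ≤ n →
    (n + 1 ∸ k) * sumN n k ≡ (n C k) * ((2 * n) C n)
mainTheorem2 (suc m) k _ k≤n = begin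
  (n + 1 ∸ k) * sumN n k
    ≡⟨ cong₂ (λ a b → (a ∸ k) * b) (+-comm n 1)
             (trans (sumN≡Σsupersets m k) (Σsupersets≡flawless*binom m k k≤n)) ⟩
  (suc n ∸ k) * (c * binom (suc n) k)
    ≡⟨ solve 3 (λ d c b → d :* (c :* b) := c :* (d :* b)) refl (suc n ∸ k) c (binom (suc n) k) ⟩
  c * ((suc n ∸ k) * binom (suc n) k)
    ≡⟨ cong (c *_) (complement-absorption n k (≤-trans k≤n (n≤1+n n))) ⟩
  c * (suc n * binom n k)
    ≡⟨ solve 3 (λ c m b → c :* (m :* b) := b :* (m :* c)) refl c (suc n) (binom n k) ⟩
  binom n k * (suc n * c)
    ≡⟨ cong (binom n k *_) (trans (chung-feller-total n) (cong (λ z → binom (n + z) n) (sym (+-identityʳ n)))) ⟩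
  binom n k * binom (2 * n) n
    ≡⟨ cong₂ _*_ (binom≡C n k) (binom≡C (2 * n) n) ⟩
  (n C k) * ((2 * n) C n)
    ∎
  where
  open ≡-Reasoning
  n = suc m
  c = wordsWithFlaws n 0
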